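{- Let $s,k\ge 2$ be integers and let $G$ be a pseudo-split graph with pseudo-split partition $(C,S,I)$ that is a minimal $(s,k)$-polar obstruction. Then $G$ is imperfect (i.e. $S\neq\varnothing$), $|C|\le s$, $|I|\le k$ and $|C|+|I|\le s+k-1$. Consequently, every pseudo-split minimal $(s,k)$-polar obstruction has at most $s+k+4$ vertices, and this bound is attained when $\min\{s,k\}=2$.
   Context: All graphs are finite and simple. A pseudo-split partition of $G$ is a partition $(C,S,I)$ of $V_G$ with $C$ a clique, $I$ independent, $S=\varnothing$ or $G[S]\cong C_5$, $C$ completely adjacent to $S$, and no edges between $I$ and $S$; $G$ is pseudo-split if it has one. For nonnegative integers $s,k$, $G$ is $(s,k)$-polar if $V_G$ has a partition $(A,B)$ with $G[A]$ a complete multipartite graph with at most $s$ parts and $G[B]$ a disjoint union of at most $k$ complete graphs. A minimal $(s,k)$-polar obstruction is a graph that is not $(s,k)$-polar but every vertex-deleted subgraph of which is. -}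

module Defs where

open import Data.Nat using (ℕ; zero; suc; _+_)
open import Data.Bool using (Bool; true; false; _∨_)
open import Data.Fin using (Fin; zero; suc; punchIn; _≟_)
open import Data.Product using (Σ; ∃; _×_; _,_)
open import Data.Sum using (_⊎_)
open import Relation.Nullary using (¬_)
open import Relation.Nullary.Decidable using (⌊_⌋)
open import Relation.Binary.PropositionalEquality using (_≡_; _≢_)
open import Function.Definitions using (Injective)

record Graph (n : ℕ) : Set where
  field
    adj    : Fin n → Fin n → Bool
    sym    : ∀ u v → adj u v ≡ adj v u
    irrefl : ∀ v → adj v v ≡ false

open Graph public

Edge : ∀ {n} → Graph n → Fin n → Fin n → Set
Edge G u v = adj G u v ≡ true

_─_ : ∀ {n} → Graph (suc n) → Fin (suc n) → Graph n
G ─ v = record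
  { adj    = λ i j → adj G (punchIn v i) (punchIn v j)
  ; sym    = λ i j → sym G (punchIn v i) (punchIn v j)
  ; irrefl = λ i → irrefl G (punchIn v i)
  }

-- G is (s,k)-polar: a partition (A,B) of V (inA v ≡ true iff v ∈ A),
-- G[A] complete multipartite with at most s parts (the parts are the
-- fibres of p : Fin n → Fin s, distinct vertices of A adjacent iff in
-- different parts), G[B] a disjoint union of at most k complete graphs
-- (the components are the fibres of q : Fin n → Fin k, distinct vertices
-- of B adjacent iff in the same component).
Polar : ℕ → ℕ → ∀ {n} → Graph n → Set
Polar s k {n} G =
  Σ (Fin n → Bool) λ inA →
  Σ (Fin n → Fin s) λ p →
  Σ (Fin n → Fin k) λ q →
    (∀ u v → inA u ≡ true → inA v ≡ true → u ≢ v →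
       (Edge G u v → p u ≢ p v) × (p u ≢ p v → Edge G u v))
  × (∀ u v → inA u ≡ false → inA v ≡ false → u ≢ v →
       (Edge G u v → q u ≡ q v) × (q u ≡ q v → Edge G u v))

MinimalObstruction : ℕ → ℕ → ∀ {n} → Graph n → Set
MinimalObstruction s k {zero}  G = ¬ Polar s k G
MinimalObstruction s k {suc n} G = ¬ Polar s k G × (∀ v → Polar s k (G ─ v))

data Part : Set where
  Cl St Is : Part

next5 : Fin 5 → Fin 5
next5 zero = suc zero
next5 (suc zero) = suc (suc zero)
next5 (suc (suc zero)) = suc (suc (suc zero))
next5 (suc (suc (suc zero))) = suc (suc (suc (suc zero)))
next5 (suc (suc (suc (suc zero)))) = zero

c5adj : Fin 5 → Fin 5 → Bool
c5adj i j = ⌊ next5 i ≟ j ⌋ ∨ ⌊ next5 j ≟ i ⌋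

InducesC5 : ∀ {n} → Graph n → (Fin n → Part) → Set
InducesC5 {n} G lab =
  Σ (Fin 5 → Fin n) λ f →
    Injective _≡_ _≡_ f
  × (∀ i → lab (f i) ≡ St)
  × (∀ v → lab v ≡ St → ∃ λ i → f i ≡ v)
  × (∀ i j → adj G (f i) (f j) ≡ c5adj i j)

-- lab encodes the partition (C,S,I): C = lab⁻¹ Cl, S = lab⁻¹ St, I = lab⁻¹ Is.
IsPseudoSplitPartition : ∀ {n} → Graph n → (Fin n → Part) → Set
IsPseudoSplitPartition {n} G lab =
    (∀ u v → lab u ≡ Cl → lab v ≡ Cl → u ≢ v → Edge G u v)
  × (∀ u v → lab u ≡ Is → lab v ≡ Is → ¬ Edge G u v)
  × ((∀ v → lab v ≢ St) ⊎ InducesC5 G lab)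
  × (∀ u v → lab u ≡ Cl → lab v ≡ St → Edge G u v)
  × (∀ u v → lab u ≡ Is → lab v ≡ St → ¬ Edge G u v)

PseudoSplit : ∀ {n} → Graph n → Set
PseudoSplit {n} G = Σ (Fin n → Part) λ lab → IsPseudoSplitPartition G lab

isLabel : Part → Part → Bool
isLabel Cl Cl = true
isLabel St St = true
isLabel Is Is = true
isLabel _  _  = false

count : ∀ {n} → Part → (Fin n → Part) → ℕ
count {zero}  x lab = 0
count {suc n} x lab with isLabel x (lab zero)
... | true  = suc (count x (λ i → lab (suc i)))
... | false = count x (λ i → lab (suc i))

module Submission where

-- A split graph
-- is polar, so G[S] is a 5-cycle, and in any polar partition (A, B) of G or of G − v (v ∉ S) the
-- cycle is split in one of two ways: A contains an edge of it and B a vertex, which forces every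
-- I-vertex into B and every C-vertex with an I-neighbour into A, or A contains a vertex and B a
-- non-edge, which forces C into A and every I-vertex with a C-non-neighbour into B. So polarity
-- is equivalent to one of two pairs of counting inequalities ("bounds A" or "bounds B"). Since G
-- is not polar but every G − v is, both fail for G and one holds for every G − v with v ∉ S;
-- comparing the two for well-chosen v gives |C| ≤ s, |I| ≤ k and |C| + |I| < s + k, hence
-- |V(G)| ≤ s + k + 4. For s = 2 (resp. k = 2) the bounds are tight for the graph with one
-- C-vertex, k I-vertices and no C–I edges (resp. s C-vertices, one I-vertex and all C–I edges).

open import Defs
open import Data.Nat using (ℕ; zero; suc; _+_; _∸_; _≤_; _<_; _⊓_; z≤n; s≤s; NonZero; >-nonZero; _%_)
open import Data.Nat.DivMod using (_mod_; m<n⇒m%n≡m; m%n<n)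
open import Data.Nat.Properties hiding (_≟_)
import Data.Nat.Properties as ℕ
open import Data.Bool using (Bool; true; false; not; if_then_else_)
import Data.Bool.Properties as Bool
open import Data.Fin using (Fin; zero; suc; toℕ; fromℕ<; punchIn; punchOut; splitAt; join; _↑ˡ_; _↑ʳ_)
open import Data.Fin.Properties as Fin using (_≟_; all?; any?)
open import Data.Product using (Σ; ∃; ∃₂; ∃-syntax; _×_; _,_; proj₁; proj₂)
import Data.Product as Product
open import Data.Sum using (_⊎_; inj₁; inj₂; [_,_]′)
import Data.Sum as Sum
open import Data.Empty using (⊥; ⊥-elim)
open import Function using (_∘_; case_of_)
open import Function.Definitions using (Injective)
open import Level using (0ℓ)
open import Relation.Nullary using (¬_; Dec; yes; no; does; ¬?; contradiction)
open import Relation.Nullary.Decidable using (dec-true; dec-false; from-yes; map′; _→-dec_; _×-dec_; _⊎-dec_)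
open import Relation.Unary using (Pred; Decidable; _⊆_; _∩_; _∪_; ∁; ｛_｝; U)
open import Relation.Unary.Properties using (_∩?_; _∪?_; ∁?; U?)
open import Relation.Binary.PropositionalEquality using (_≡_; _≢_; refl; trans; cong; cong₂; subst)
import Relation.Binary.PropositionalEquality as ≡

-- Counting vertices

size : ∀ {n} {P : Pred (Fin n) 0ℓ} → Decidable P → ℕ
size {zero}  P? = 0
size {suc n} P? = if does (P? zero) then suc (size (P? ∘ suc)) else size (P? ∘ suc)

size-mono : ∀ {n} {P Q : Pred (Fin n) 0ℓ} (P? : Decidable P) (Q? : Decidable Q) → P ⊆ Q → size P? ≤ size Q?
size-mono {zero}  _  _  _ = z≤n
size-mono {suc n} P? Q? P⊆Q with P? zero | Q? zero
... | yes _ | yes _ = s≤s (size-mono (P? ∘ suc) (Q? ∘ suc) P⊆Q)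
... | yes p | no ¬q = contradiction (P⊆Q p) ¬q
... | no _  | yes _ = m≤n⇒m≤1+n (size-mono (P? ∘ suc) (Q? ∘ suc) P⊆Q)
... | no _  | no _  = size-mono (P? ∘ suc) (Q? ∘ suc) P⊆Q

size-cong : ∀ {n} {P Q : Pred (Fin n) 0ℓ} (P? : Decidable P) (Q? : Decidable Q) →
            P ⊆ Q → Q ⊆ P → size P? ≡ size Q?
size-cong P? Q? P⊆Q Q⊆P = ≤-antisym (size-mono P? Q? P⊆Q) (size-mono Q? P? Q⊆P)

size-all : ∀ {n} {P : Pred (Fin n) 0ℓ} (P? : Decidable P) → (∀ v → P v) → size P? ≡ n
size-all {zero}  P? all = refl
size-all {suc n} P? all with P? zero
... | yes _ = cong suc (size-all (P? ∘ suc) (all ∘ suc))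
... | no ¬p = contradiction (all zero) ¬p

size-none : ∀ {n} {P : Pred (Fin n) 0ℓ} (P? : Decidable P) → (∀ v → ¬ P v) → size P? ≡ 0
size-none {zero}  P? none = refl
size-none {suc n} P? none with P? zero
... | yes p = contradiction p (none zero)
... | no _  = size-none (P? ∘ suc) (none ∘ suc)

size-↑ : ∀ m {n} {P : Pred (Fin (m + n)) 0ℓ} (P? : Decidable P) →
         size P? ≡ size (P? ∘ (_↑ˡ n)) + size (P? ∘ (m ↑ʳ_))
size-↑ zero    P? = refl
size-↑ (suc m) P? with does (P? zero)
... | true  = cong suc (size-↑ m (P? ∘ suc))
... | false = size-↑ m (P? ∘ suc)

size-insert : ∀ {n} {P : Pred (Fin n) 0ℓ} (P? : Decidable P) {v} → ¬ P v →
              size (P? ∪? (v ≟_)) ≡ suc (size P?)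
size-insert {suc n} P? {zero} ¬Pv with P? zero
... | yes Pv = contradiction Pv ¬Pv
... | no _   = cong suc (size-cong ((P? ∪? (zero ≟_)) ∘ suc) (P? ∘ suc) [ (λ p → p) , (λ ()) ]′ inj₁)
size-insert {suc n} P? {suc v} ¬Pv with P? zero
... | yes _ = cong suc (trans (size-cong ((P? ∪? (suc v ≟_)) ∘ suc) ((P? ∘ suc) ∪? (v ≟_))
                                         (Sum.map₂ Fin.suc-injective) (Sum.map₂ (cong suc)))
                              (size-insert (P? ∘ suc) ¬Pv))
... | no _  = trans (size-cong ((P? ∪? (suc v ≟_)) ∘ suc) ((P? ∘ suc) ∪? (v ≟_))
                               (Sum.map₂ Fin.suc-injective) (Sum.map₂ (cong suc)))
                    (size-insert (P? ∘ suc) ¬Pv)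

size-insert₂ : ∀ {n} {P : Pred (Fin n) 0ℓ} (P? : Decidable P) {v w} → ¬ P v → ¬ P w → v ≢ w →
               size ((P? ∪? (v ≟_)) ∪? (w ≟_)) ≡ 2 + size P?
size-insert₂ P? ¬Pv ¬Pw v≢w = trans (size-insert (P? ∪? (_ ≟_)) [ ¬Pw , v≢w ]′) (cong suc (size-insert P? ¬Pv))

size-remove : ∀ {n} {P : Pred (Fin n) 0ℓ} (P? : Decidable P) {v} → P v →
              suc (size (P? ∩? ∁? (v ≟_))) ≡ size P?
size-remove {P = P} P? {v} Pv = trans (≡.sym (size-insert (P? ∩? ∁? (v ≟_)) λ (_ , v≢v) → v≢v refl))
                                      (size-cong _ P? [ proj₁ , (λ { refl → Pv }) ]′ split)
  where
  split : P ⊆ (P ∩ ∁ ｛ v ｝) ∪ ｛ v ｝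
  split {u} Pu with v ≟ u
  ... | yes v≡u = inj₂ v≡u
  ... | no v≢u  = inj₁ (Pu , v≢u)

size-<⇒∃ : ∀ {n} {P Q : Pred (Fin n) 0ℓ} (P? : Decidable P) (Q? : Decidable Q) →
           size P? < size Q? → ∃ λ v → Q v × ¬ P v
size-<⇒∃ {suc n} P? Q? lt with P? zero | Q? zero
... | no ¬p | yes q = zero , q , ¬p
... | yes _ | yes _ = Product.map suc (λ x → x) (size-<⇒∃ (P? ∘ suc) (Q? ∘ suc) (≤-pred lt))
... | yes _ | no _  = Product.map suc (λ x → x) (size-<⇒∃ (P? ∘ suc) (Q? ∘ suc) (<-trans (n<1+n _) lt))
... | no _  | no _  = Product.map suc (λ x → x) (size-<⇒∃ (P? ∘ suc) (Q? ∘ suc) lt)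

size-positive⇒∃ : ∀ {n} {P : Pred (Fin n) 0ℓ} (P? : Decidable P) → 0 < size P? → ∃ P
size-positive⇒∃ {suc n} P? pos with P? zero
... | yes p = zero , p
... | no _  = Product.map suc (λ p → p) (size-positive⇒∃ (P? ∘ suc) pos)

enumerate : ∀ {n} {P : Pred (Fin n) 0ℓ} (P? : Decidable P) → Fin (size P?) → Fin n
enumerate {suc n} P? j with P? zero
enumerate {suc n} P? zero    | yes _ = zero
enumerate {suc n} P? (suc j) | yes _ = suc (enumerate (P? ∘ suc) j)
enumerate {suc n} P? j       | no _  = suc (enumerate (P? ∘ suc) j)

enumerate-∈ : ∀ {n} {P : Pred (Fin n) 0ℓ} (P? : Decidable P) (j : Fin (size P?)) → P (enumerate P? j)
enumerate-∈ {suc n} P? j with P? zero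
enumerate-∈ {suc n} P? zero    | yes p = p
enumerate-∈ {suc n} P? (suc j) | yes _ = enumerate-∈ (P? ∘ suc) j
enumerate-∈ {suc n} P? j       | no _  = enumerate-∈ (P? ∘ suc) j

enumerate-injective : ∀ {n} {P : Pred (Fin n) 0ℓ} (P? : Decidable P) → Injective _≡_ _≡_ (enumerate P?)
enumerate-injective {suc n} P? {i} {j} eq with P? zero
enumerate-injective {suc n} P? {zero}  {zero}  eq | yes _ = refl
enumerate-injective {suc n} P? {suc i} {suc j} eq | yes _ =
  cong suc (enumerate-injective (P? ∘ suc) (Fin.suc-injective eq))
enumerate-injective {suc n} P? {i}     {j}     eq | no _  =
  enumerate-injective (P? ∘ suc) (Fin.suc-injective eq)

injection⇒size≤ : ∀ {n m} {P : Pred (Fin n) 0ℓ} (P? : Decidable P) (g : Fin n → ℕ) →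
                  (∀ {v} → P v → g v < m) → (∀ {u v} → P u → P v → g u ≡ g v → u ≡ v) →
                  size P? ≤ m
injection⇒size≤ {m = m} P? g g<m g-injective = Fin.injective⇒≤ {f = h} h-injective
  where
  h : Fin (size P?) → Fin m
  h j = fromℕ< (g<m (enumerate-∈ P? j))
  h-injective : Injective _≡_ _≡_ h
  h-injective {i} {j} eq = enumerate-injective P? (g-injective (enumerate-∈ P? i) (enumerate-∈ P? j)
    (Fin.fromℕ<-injective _ _ (g<m (enumerate-∈ P? i)) (g<m (enumerate-∈ P? j)) eq))

rank : ∀ {n} {P : Pred (Fin n) 0ℓ} → Decidable P → Fin n → ℕ
rank {suc n} P? zero    = 0
rank {suc n} P? (suc v) with P? zero
... | yes _ = suc (rank (P? ∘ suc) v)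
... | no _  = rank (P? ∘ suc) v

rank-< : ∀ {n} {P : Pred (Fin n) 0ℓ} (P? : Decidable P) {v} → P v → rank P? v < size P?
rank-< {suc n} P? {zero} Pv with P? zero
... | yes _  = s≤s z≤n
... | no ¬Pv = contradiction Pv ¬Pv
rank-< {suc n} P? {suc v} Pv with P? zero
... | yes _ = s≤s (rank-< (P? ∘ suc) Pv)
... | no _  = rank-< (P? ∘ suc) Pv

rank-injective : ∀ {n} {P : Pred (Fin n) 0ℓ} (P? : Decidable P) {u v} → P u → P v →
                 rank P? u ≡ rank P? v → u ≡ v
rank-injective {suc n} P? {zero}  {zero}  _  _  _ = refl
rank-injective {suc n} P? {zero}  {suc v} Pu Pv eq with P? zero
... | no ¬Pu = contradiction Pu ¬Pu
rank-injective {suc n} P? {suc u} {zero}  Pu Pv eq with P? zero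
... | no ¬Pv = contradiction Pv ¬Pv
rank-injective {suc n} P? {suc u} {suc v} Pu Pv eq with P? zero
... | yes _ = cong suc (rank-injective (P? ∘ suc) Pu Pv (suc-injective eq))
... | no _  = cong suc (rank-injective (P? ∘ suc) Pu Pv eq)

-- The 5-cycle

c5-irrefl : ∀ i → c5adj i i ≡ false
c5-irrefl = from-yes (all? λ i → c5adj i i Bool.≟ false)

c5-sym : ∀ i j → c5adj i j ≡ c5adj j i
c5-sym = from-yes (all? λ i → all? λ j → c5adj i j Bool.≟ c5adj j i)

c5-neighbours-nonadjacent : ∀ r i j → i ≢ j → c5adj r i ≡ true → c5adj r j ≡ true → c5adj i j ≡ false
c5-neighbours-nonadjacent = from-yes (all? λ r → all? λ i → all? λ j →
  ¬? (i ≟ j) →-dec (c5adj r i Bool.≟ true →-dec (c5adj r j Bool.≟ true →-dec c5adj i j Bool.≟ false)))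

c5-non-neighbours-adjacent : ∀ r i j → i ≢ r → j ≢ r → i ≢ j →
                             c5adj r i ≡ false → c5adj r j ≡ false → c5adj i j ≡ true
c5-non-neighbours-adjacent = from-yes (all? λ r → all? λ i → all? λ j →
  ¬? (i ≟ r) →-dec (¬? (j ≟ r) →-dec (¬? (i ≟ j) →-dec
    (c5adj r i Bool.≟ false →-dec (c5adj r j Bool.≟ false →-dec c5adj i j Bool.≟ true)))))

-- Every 2-colouring t of the 5-cycle (t i ≡ true: vertex i lies in A) has one of these shapes
-- (c5-shape). The last two cannot occur in a polar partition: an induced co-P₃ does not fit in a
-- complete multipartite graph, nor an induced P₃ in a disjoint union of cliques.

EdgeInA NonEdgeInB CoP3InA P3InB : (Fin 5 → Bool) → Set
EdgeInA t    = ∃[ i ] ∃[ j ] ∃[ l ] t i ≡ true × t j ≡ true × t l ≡ false × c5adj i j ≡ true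
NonEdgeInB t = ∃[ i ] ∃[ j ] ∃[ l ] t i ≡ true × t j ≡ false × t l ≡ false × j ≢ l × c5adj j l ≡ false
CoP3InA t    = ∃[ i ] ∃[ j ] ∃[ l ] t i ≡ true × t j ≡ true × t l ≡ true ×
                 c5adj i j ≡ true × l ≢ i × l ≢ j × c5adj l i ≡ false × c5adj l j ≡ false
P3InB t      = ∃[ i ] ∃[ j ] ∃[ l ] t i ≡ false × t j ≡ false × t l ≡ false ×
                 c5adj i j ≡ true × c5adj j l ≡ true × i ≢ l × c5adj i l ≡ false

Shape : (Fin 5 → Bool) → Set
Shape t = EdgeInA t ⊎ NonEdgeInB t ⊎ CoP3InA t ⊎ P3InB t

shape? : ∀ t → Dec (Shape t)
shape? t = edgeInA ⊎-dec nonEdgeInB ⊎-dec coP3InA ⊎-dec p3InB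
  where
  t≟ : ∀ i b → Dec (t i ≡ b)
  t≟ i b = t i Bool.≟ b
  c5≟ : ∀ i j b → Dec (c5adj i j ≡ b)
  c5≟ i j b = c5adj i j Bool.≟ b
  edgeInA : Dec (EdgeInA t)
  edgeInA = any? λ i → any? λ j → any? λ l → t≟ i true ×-dec t≟ j true ×-dec t≟ l false ×-dec c5≟ i j true
  nonEdgeInB : Dec (NonEdgeInB t)
  nonEdgeInB = any? λ i → any? λ j → any? λ l →
    t≟ i true ×-dec t≟ j false ×-dec t≟ l false ×-dec ¬? (j ≟ l) ×-dec c5≟ j l false
  coP3InA : Dec (CoP3InA t)
  coP3InA = any? λ i → any? λ j → any? λ l → t≟ i true ×-dec t≟ j true ×-dec t≟ l true ×-dec
    c5≟ i j true ×-dec ¬? (l ≟ i) ×-dec ¬? (l ≟ j) ×-dec c5≟ l i false ×-dec c5≟ l j false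
  p3InB : Dec (P3InB t)
  p3InB = any? λ i → any? λ j → any? λ l → t≟ i false ×-dec t≟ j false ×-dec t≟ l false ×-dec
    c5≟ i j true ×-dec c5≟ j l true ×-dec ¬? (i ≟ l) ×-dec c5≟ i l false

shape-cong : ∀ {t u : Fin 5 → Bool} → (∀ i → t i ≡ u i) → Shape t → Shape u
shape-cong {t} {u} t≗u = Sum.map reshape (Sum.map reshape (Sum.map reshape reshape))
  where
  reshape : ∀ {b₁ b₂ b₃} {R : Fin 5 → Fin 5 → Fin 5 → Set} →
            (∃[ i ] ∃[ j ] ∃[ l ] t i ≡ b₁ × t j ≡ b₂ × t l ≡ b₃ × R i j l) →
            (∃[ i ] ∃[ j ] ∃[ l ] u i ≡ b₁ × u j ≡ b₂ × u l ≡ b₃ × R i j l)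
  reshape (i , j , l , ti , tj , tl , r) =
    i , j , l , trans (≡.sym (t≗u i)) ti , trans (≡.sym (t≗u j)) tj , trans (≡.sym (t≗u l)) tl , r

tabulate5 : Bool → Bool → Bool → Bool → Bool → Fin 5 → Bool
tabulate5 b₀ _  _  _  _  zero                             = b₀
tabulate5 _  b₁ _  _  _  (suc zero)                       = b₁
tabulate5 _  _  b₂ _  _  (suc (suc zero))                 = b₂
tabulate5 _  _  _  b₃ _  (suc (suc (suc zero)))           = b₃
tabulate5 _  _  _  _  b₄ (suc (suc (suc (suc zero))))     = b₄

∀-Bool? : {P : Bool → Set} → (∀ b → Dec (P b)) → Dec (∀ b → P b)
∀-Bool? P? = map′ (λ (t , f) → λ { true → t ; false → f }) (λ h → h true , h false) (P? true ×-dec P? false)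

-- Proved by running a decision procedure on all 32 colourings; opaque so that it is not re-run
-- whenever a term mentioning it is normalised.
opaque
  c5-shape : ∀ t → Shape t
  c5-shape t = shape-cong tabulate5-t (every-shape (t zero) (t (suc zero)) (t (suc (suc zero)))
                                                   (t (suc (suc (suc zero)))) (t (suc (suc (suc (suc zero))))))
    where
    every-shape : ∀ b₀ b₁ b₂ b₃ b₄ → Shape (tabulate5 b₀ b₁ b₂ b₃ b₄)
    every-shape = from-yes (∀-Bool? λ b₀ → ∀-Bool? λ b₁ → ∀-Bool? λ b₂ → ∀-Bool? λ b₃ → ∀-Bool? λ b₄ →
                              shape? (tabulate5 b₀ b₁ b₂ b₃ b₄))
    tabulate5-t : ∀ i → tabulate5 (t zero) (t (suc zero)) (t (suc (suc zero)))
                                  (t (suc (suc (suc zero)))) (t (suc (suc (suc (suc zero))))) i ≡ t i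
    tabulate5-t zero                         = refl
    tabulate5-t (suc zero)                   = refl
    tabulate5-t (suc (suc zero))             = refl
    tabulate5-t (suc (suc (suc zero)))       = refl
    tabulate5-t (suc (suc (suc (suc zero)))) = refl

-- Two polar partitions of the 5-cycle 0–1–2–3–4–0: in α, A = {0, 1, 2} with parts {0, 2}, {1} and
-- B = {3, 4} a single clique; in β, A = {0, 2} a single part and B has the cliques {1}, {3, 4}.

inAα inAβ : Fin 5 → Bool
inAα = λ { zero → true ; (suc zero) → true ; (suc (suc zero)) → true ; _ → false }
inAβ = λ { zero → true ; (suc (suc zero)) → true ; _ → false }

partα compβ : Fin 5 → ℕ
partα = λ { (suc zero) → 1 ; _ → 0 }
compβ = λ { (suc (suc (suc zero))) → 1 ; (suc (suc (suc (suc zero)))) → 1 ; _ → 0 }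

c5-α-multipartite : ∀ i j → i ≢ j → inAα i ≡ true → inAα j ≡ true → c5adj i j ≡ not (does (partα i ℕ.≟ partα j))
c5-α-multipartite = from-yes (all? λ i → all? λ j → ¬? (i ≟ j) →-dec (inAα i Bool.≟ true →-dec
  (inAα j Bool.≟ true →-dec c5adj i j Bool.≟ not (does (partα i ℕ.≟ partα j)))))

c5-α-cluster : ∀ i j → i ≢ j → inAα i ≡ false → inAα j ≡ false → c5adj i j ≡ true
c5-α-cluster = from-yes (all? λ i → all? λ j → ¬? (i ≟ j) →-dec (inAα i Bool.≟ false →-dec
  (inAα j Bool.≟ false →-dec c5adj i j Bool.≟ true)))

c5-β-multipartite : ∀ i j → i ≢ j → inAβ i ≡ true → inAβ j ≡ true → c5adj i j ≡ false
c5-β-multipartite = from-yes (all? λ i → all? λ j → ¬? (i ≟ j) →-dec (inAβ i Bool.≟ true →-dec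
  (inAβ j Bool.≟ true →-dec c5adj i j Bool.≟ false)))

c5-β-cluster : ∀ i j → i ≢ j → inAβ i ≡ false → inAβ j ≡ false → c5adj i j ≡ does (compβ i ℕ.≟ compβ j)
c5-β-cluster = from-yes (all? λ i → all? λ j → ¬? (i ≟ j) →-dec (inAβ i Bool.≟ false →-dec
  (inAβ j Bool.≟ false →-dec c5adj i j Bool.≟ does (compβ i ℕ.≟ compβ j))))

partα≤1 : ∀ i → partα i ≤ 1
partα≤1 = from-yes (all? λ i → partα i ℕ.≤? 1)

compβ≤1 : ∀ i → compβ i ≤ 1
compβ≤1 = from-yes (all? λ i → compβ i ℕ.≤? 1)

-- Polar partitions of a set of alive vertices

does-true⇒ : ∀ {X : Set} (X? : Dec X) → does X? ≡ true → X
does-true⇒ (yes x) _ = x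

does-false⇒ : ∀ {X : Set} (X? : Dec X) → does X? ≡ false → ¬ X
does-false⇒ (no ¬x) _ = ¬x

≡does : ∀ {X : Set} {b} (X? : Dec X) → (b ≡ true → X) → (X → b ≡ true) → b ≡ does X?
≡does {b = true}  X? b⇒X _   = ≡.sym (dec-true X? (b⇒X refl))
≡does {b = false} X? _   X⇒b = ≡.sym (dec-false X? λ x → contradiction (X⇒b x) λ ())

≢⇒not-does : ∀ {x y : ℕ} → x ≢ y → not (does (x ℕ.≟ y)) ≡ true
≢⇒not-does x≢y = cong not (dec-false (_ ℕ.≟ _) x≢y)

edge⇒≢ : ∀ {n} (G : Graph n) {u v} → Edge G u v → u ≢ v
edge⇒≢ G {u} e refl = contradiction (trans (≡.sym e) (irrefl G u)) λ ()

Clique Independent : ∀ {n} → Graph n → Pred (Fin n) 0ℓ → Set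
Clique      G Q = ∀ {u v} → Q u → Q v → u ≢ v → Edge G u v
Independent G Q = ∀ {u v} → Q u → Q v → u ≢ v → adj G u v ≡ false

clique-insert : ∀ {n} {G : Graph n} {Q : Pred (Fin n) 0ℓ} {a} →
                Clique G Q → (∀ {u} → Q u → Edge G u a) → Clique G (Q ∪ ｛ a ｝)
clique-insert         clique toA (inj₁ qu)   (inj₁ qv)   u≢v = clique qu qv u≢v
clique-insert         clique toA (inj₁ qu)   (inj₂ refl) _   = toA qu
clique-insert {G = G} clique toA (inj₂ refl) (inj₁ qv)   _   = trans (sym G _ _) (toA qv)
clique-insert         clique toA (inj₂ refl) (inj₂ refl) a≢a = contradiction refl a≢a

independent-insert : ∀ {n} {G : Graph n} {Q : Pred (Fin n) 0ℓ} {a} →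
                     Independent G Q → (∀ {u} → Q u → adj G u a ≡ false) → Independent G (Q ∪ ｛ a ｝)
independent-insert         indep toA (inj₁ qu)   (inj₁ qv)   u≢v = indep qu qv u≢v
independent-insert         indep toA (inj₁ qu)   (inj₂ refl) _   = toA qu
independent-insert {G = G} indep toA (inj₂ refl) (inj₁ qv)   _   = trans (sym G _ _) (toA qv)
independent-insert         indep toA (inj₂ refl) (inj₂ refl) a≢a = contradiction refl a≢a

-- A polar partition of the alive vertices, with parts of A and cliques of B named by natural
-- numbers; the labels are only constrained on alive vertices.
record PolarOn (s k : ℕ) {n} (G : Graph n) (Alive : Pred (Fin n) 0ℓ) : Set where
  field
    inA          : Fin n → Bool
    part comp    : Fin n → ℕ
    part<        : ∀ {v} → Alive v → inA v ≡ true → part v < s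
    comp<        : ∀ {v} → Alive v → inA v ≡ false → comp v < k
    multipartite : ∀ {u v} → Alive u → Alive v → inA u ≡ true → inA v ≡ true → u ≢ v →
                   adj G u v ≡ not (does (part u ℕ.≟ part v))
    cluster      : ∀ {u v} → Alive u → Alive v → inA u ≡ false → inA v ≡ false → u ≢ v →
                   adj G u v ≡ does (comp u ℕ.≟ comp v)

  edge⇒part-≢ : ∀ {u v} → Alive u → Alive v → inA u ≡ true → inA v ≡ true → Edge G u v → part u ≢ part v
  edge⇒part-≢ au av iu iv e = does-false⇒ (part _ ℕ.≟ part _)
    (Bool.not-injective (trans (≡.sym (multipartite au av iu iv (edge⇒≢ G e))) e))

  nonedge⇒part-≡ : ∀ {u v} → Alive u → Alive v → inA u ≡ true → inA v ≡ true → u ≢ v →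
                   adj G u v ≡ false → part u ≡ part v
  nonedge⇒part-≡ au av iu iv u≢v e = does-true⇒ (part _ ℕ.≟ part _)
    (Bool.not-injective (trans (≡.sym (multipartite au av iu iv u≢v)) e))

  edge⇒comp-≡ : ∀ {u v} → Alive u → Alive v → inA u ≡ false → inA v ≡ false → Edge G u v → comp u ≡ comp v
  edge⇒comp-≡ au av iu iv e = does-true⇒ (comp _ ℕ.≟ comp _) (trans (≡.sym (cluster au av iu iv (edge⇒≢ G e))) e)

  nonedge⇒comp-≢ : ∀ {u v} → Alive u → Alive v → inA u ≡ false → inA v ≡ false → u ≢ v →
                   adj G u v ≡ false → comp u ≢ comp v
  nonedge⇒comp-≢ au av iu iv u≢v e = does-false⇒ (comp _ ℕ.≟ comp _) (trans (≡.sym (cluster au av iu iv u≢v)) e)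

  clique⇒size≤ : ∀ {Q : Pred (Fin n) 0ℓ} (Q? : Decidable Q) → Q ⊆ Alive → Q ⊆ (λ v → inA v ≡ true) →
                 Clique G Q → size Q? ≤ s
  clique⇒size≤ {Q} Q? alive inA clique = injection⇒size≤ Q? part (λ q → part< (alive q) (inA q)) injective
    where
    injective : ∀ {u v} → Q u → Q v → part u ≡ part v → u ≡ v
    injective {u} {v} qu qv eq with u ≟ v
    ... | yes u≡v = u≡v
    ... | no u≢v  = contradiction eq (edge⇒part-≢ (alive qu) (alive qv) (inA qu) (inA qv) (clique qu qv u≢v))

  independent⇒size≤ : ∀ {Q : Pred (Fin n) 0ℓ} (Q? : Decidable Q) → Q ⊆ Alive → Q ⊆ (λ v → inA v ≡ false) →
                      Independent G Q → size Q? ≤ k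
  independent⇒size≤ {Q} Q? alive inB independent = injection⇒size≤ Q? comp (λ q → comp< (alive q) (inB q)) injective
    where
    injective : ∀ {u v} → Q u → Q v → comp u ≡ comp v → u ≡ v
    injective {u} {v} qu qv eq with u ≟ v
    ... | yes u≡v = u≡v
    ... | no u≢v  = contradiction eq (nonedge⇒comp-≢ (alive qu) (alive qv) (inB qu) (inB qv) u≢v (independent qu qv u≢v))

  no-coP3-in-A : ∀ {a b c} → Alive a → Alive b → Alive c → inA a ≡ true → inA b ≡ true → inA c ≡ true →
                 Edge G a b → c ≢ a → c ≢ b → adj G c a ≡ false → adj G c b ≡ false → ⊥
  no-coP3-in-A aa ab ac ia ib ic ab-edge c≢a c≢b ca cb = edge⇒part-≢ aa ab ia ib ab-edge
    (trans (≡.sym (nonedge⇒part-≡ ac aa ic ia c≢a ca)) (nonedge⇒part-≡ ac ab ic ib c≢b cb))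

  no-P3-in-B : ∀ {a b c} → Alive a → Alive b → Alive c → inA a ≡ false → inA b ≡ false → inA c ≡ false →
               Edge G a b → Edge G b c → a ≢ c → adj G a c ≡ false → ⊥
  no-P3-in-B aa ab ac ia ib ic ab-edge bc-edge a≢c ac-nonedge = nonedge⇒comp-≢ aa ac ia ic a≢c ac-nonedge
    (trans (edge⇒comp-≡ aa ab ia ib ab-edge) (edge⇒comp-≡ ab ac ib ic bc-edge))

mod-injective : ∀ {m x y} .{{_ : NonZero m}} → x < m → y < m → x mod m ≡ y mod m → x ≡ y
mod-injective {m} {x} {y} x<m y<m eq = begin
  x              ≡⟨ m<n⇒m%n≡m x<m ⟨
  x % m          ≡⟨ Fin.toℕ-fromℕ< (m%n<n x m) ⟨
  toℕ (x mod m)  ≡⟨ cong toℕ eq ⟩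
  toℕ (y mod m)  ≡⟨ Fin.toℕ-fromℕ< (m%n<n y m) ⟩
  y % m          ≡⟨ m<n⇒m%n≡m y<m ⟩
  y              ∎
  where open ≡.≡-Reasoning

polarOn⇒polar : ∀ {s k m n} .{{_ : NonZero s}} .{{_ : NonZero k}} {G : Graph n} {Alive : Pred (Fin n) 0ℓ}
                (H : Graph m) (e : Fin m → Fin n) → Injective _≡_ _≡_ e → (∀ i → Alive (e i)) →
                (∀ i j → adj H i j ≡ adj G (e i) (e j)) → PolarOn s k G Alive → Polar s k H
polarOn⇒polar {s} {k} {G = G} H e e-injective alive adj-e P =
  inA ∘ e , (λ i → part (e i) mod s) , (λ i → comp (e i) mod k) , multipartite′ , cluster′
  where
  open PolarOn P
  multipartite′ : ∀ i j → inA (e i) ≡ true → inA (e j) ≡ true → i ≢ j →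
                  (Edge H i j → part (e i) mod s ≢ part (e j) mod s) × (part (e i) mod s ≢ part (e j) mod s → Edge H i j)
  multipartite′ i j ia ja i≢j =
      (λ edge eq → does-false⇒ (part _ ℕ.≟ part _)
                     (Bool.not-injective (trans (≡.sym adjacency) (trans (≡.sym (adj-e i j)) edge)))
                     (mod-injective (part< (alive i) ia) (part< (alive j) ja) eq))
    , λ ne → trans (adj-e i j) (trans adjacency (≢⇒not-does (ne ∘ cong (_mod s))))
    where
    adjacency : adj G (e i) (e j) ≡ not (does (part (e i) ℕ.≟ part (e j)))
    adjacency = multipartite (alive i) (alive j) ia ja (i≢j ∘ e-injective)
  cluster′ : ∀ i j → inA (e i) ≡ false → inA (e j) ≡ false → i ≢ j →
             (Edge H i j → comp (e i) mod k ≡ comp (e j) mod k) × (comp (e i) mod k ≡ comp (e j) mod k → Edge H i j)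
  cluster′ i j ia ja i≢j =
      (λ edge → cong (_mod k) (does-true⇒ (comp _ ℕ.≟ comp _) (trans (≡.sym adjacency) (trans (≡.sym (adj-e i j)) edge))))
    , λ eq → trans (adj-e i j) (trans adjacency (dec-true (comp _ ℕ.≟ comp _)
               (mod-injective (comp< (alive i) ia) (comp< (alive j) ja) eq)))
    where
    adjacency : adj G (e i) (e j) ≡ does (comp (e i) ℕ.≟ comp (e j))
    adjacency = cluster (alive i) (alive j) ia ja (i≢j ∘ e-injective)

polarOn-U⇒polar : ∀ {s k n} .{{_ : NonZero s}} .{{_ : NonZero k}} {G : Graph n} → PolarOn s k G U → Polar s k G
polarOn-U⇒polar {G = G} = polarOn⇒polar G (λ v → v) (λ eq → eq) _ (λ _ _ → refl)

polarOn-─⇒polar : ∀ {s k n} .{{_ : NonZero s}} .{{_ : NonZero k}} {G : Graph (suc n)} (v : Fin (suc n)) →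
                  PolarOn s k G (∁ ｛ v ｝) → Polar s k (G ─ v)
polarOn-─⇒polar {G = G} v = polarOn⇒polar (G ─ v) (punchIn v) (Fin.punchIn-injective v _ _)
                                         (λ i → Fin.punchInᵢ≢i v i ∘ ≡.sym) (λ _ _ → refl)

multipartite-toℕ : ∀ {s n} (G : Graph n) (p : Fin n → Fin s) {u v} →
                   (Edge G u v → p u ≢ p v) × (p u ≢ p v → Edge G u v) →
                   adj G u v ≡ not (does (toℕ (p u) ℕ.≟ toℕ (p v)))
multipartite-toℕ G p {u} {v} (edge⇒≢ , ≢⇒edge) =
  ≡does (¬? (toℕ (p u) ℕ.≟ toℕ (p v))) (λ e eq → edge⇒≢ e (Fin.toℕ-injective eq)) (λ ne → ≢⇒edge (ne ∘ cong toℕ))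

cluster-toℕ : ∀ {k n} (G : Graph n) (q : Fin n → Fin k) {u v} →
              (Edge G u v → q u ≡ q v) × (q u ≡ q v → Edge G u v) →
              adj G u v ≡ does (toℕ (q u) ℕ.≟ toℕ (q v))
cluster-toℕ G q {u} {v} (edge⇒≡ , ≡⇒edge) =
  ≡does (toℕ (q u) ℕ.≟ toℕ (q v)) (cong toℕ ∘ edge⇒≡) (≡⇒edge ∘ Fin.toℕ-injective)

polar⇒polarOn : ∀ {s k n} {G : Graph n} → Polar s k G → PolarOn s k G U
polar⇒polarOn {G = G} (inA , p , q , cA , cB) = record
  { inA          = inA
  ; part         = toℕ ∘ p
  ; comp         = toℕ ∘ q
  ; part<        = λ _ _ → Fin.toℕ<n _
  ; comp<        = λ _ _ → Fin.toℕ<n _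
  ; multipartite = λ _ _ iu iv u≢v → multipartite-toℕ G p (cA _ _ iu iv u≢v)
  ; cluster      = λ _ _ iu iv u≢v → cluster-toℕ G q (cB _ _ iu iv u≢v)
  }

extend : ∀ {n} {A : Set} (v : Fin (suc n)) → A → (Fin n → A) → Fin (suc n) → A
extend v d g u with v ≟ u
... | yes _  = d
... | no v≢u = g (punchOut v≢u)

extend-punchIn : ∀ {n} {A : Set} (v : Fin (suc n)) (d : A) (g : Fin n → A) i → extend v d g (punchIn v i) ≡ g i
extend-punchIn v d g i with v ≟ punchIn v i
... | yes v≡ = contradiction (≡.sym v≡) (Fin.punchInᵢ≢i v i)
... | no _   = cong g (trans (Fin.punchOut-cong v refl) (Fin.punchOut-punchIn v))

punchIn-onto : ∀ {n} (v u : Fin (suc n)) → v ≢ u → ∃ λ i → punchIn v i ≡ u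
punchIn-onto v u v≢u = punchOut v≢u , Fin.punchIn-punchOut v≢u

polar-─⇒polarOn : ∀ {s k n} {G : Graph (suc n)} (v : Fin (suc n)) → Polar s k (G ─ v) → PolarOn s k G (∁ ｛ v ｝)
polar-─⇒polarOn {s} {k} {G = G} v (inA , p , q , cA , cB) = record
  { inA = inA′ ; part = part ; comp = comp ; part< = part< ; comp< = comp<
  ; multipartite = multipartite ; cluster = cluster }
  where
  inA′ : Fin _ → Bool
  inA′ = extend v true inA
  part comp : Fin _ → ℕ
  part = extend v 0 (toℕ ∘ p)
  comp = extend v 0 (toℕ ∘ q)
  part< : ∀ {u} → v ≢ u → inA′ u ≡ true → part u < s
  part< {u} v≢u iu with punchIn-onto v u v≢u
  ... | i , refl rewrite extend-punchIn v 0 (toℕ ∘ p) i = Fin.toℕ<n (p i)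
  comp< : ∀ {u} → v ≢ u → inA′ u ≡ false → comp u < k
  comp< {u} v≢u iu with punchIn-onto v u v≢u
  ... | i , refl rewrite extend-punchIn v 0 (toℕ ∘ q) i = Fin.toℕ<n (q i)
  multipartite : ∀ {u w} → v ≢ u → v ≢ w → inA′ u ≡ true → inA′ w ≡ true → u ≢ w →
                 adj G u w ≡ not (does (part u ℕ.≟ part w))
  multipartite {u} {w} v≢u v≢w iu iw u≢w with punchIn-onto v u v≢u | punchIn-onto v w v≢w
  ... | i , refl | j , refl
    rewrite extend-punchIn v true inA i | extend-punchIn v true inA j
          | extend-punchIn v 0 (toℕ ∘ p) i | extend-punchIn v 0 (toℕ ∘ p) j =
    multipartite-toℕ (G ─ v) p (cA i j iu iw (u≢w ∘ cong (punchIn v)))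
  cluster : ∀ {u w} → v ≢ u → v ≢ w → inA′ u ≡ false → inA′ w ≡ false → u ≢ w →
            adj G u w ≡ does (comp u ℕ.≟ comp w)
  cluster {u} {w} v≢u v≢w iu iw u≢w with punchIn-onto v u v≢u | punchIn-onto v w v≢w
  ... | i , refl | j , refl
    rewrite extend-punchIn v true inA i | extend-punchIn v true inA j
          | extend-punchIn v 0 (toℕ ∘ q) i | extend-punchIn v 0 (toℕ ∘ q) j =
    cluster-toℕ (G ─ v) q (cB i j iu iw (u≢w ∘ cong (punchIn v)))

obstruction⇒¬polar : ∀ {s k n} {G : Graph n} → MinimalObstruction s k G → ¬ Polar s k G
obstruction⇒¬polar {n = zero}  ¬polar       = ¬polar
obstruction⇒¬polar {n = suc n} (¬polar , _) = ¬polar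

obstruction⇒polarOn-─ : ∀ {s k n} {G : Graph n} → MinimalObstruction s k G → (v : Fin n) → PolarOn s k G (∁ ｛ v ｝)
obstruction⇒polarOn-─ {n = suc n} (_ , polar-─) v = polar-─⇒polarOn v (polar-─ v)

-- Pseudo-split graphs

_≟ₚ_ : (x y : Part) → Dec (x ≡ y)
Cl ≟ₚ Cl = yes refl
Cl ≟ₚ St = no λ ()
Cl ≟ₚ Is = no λ ()
St ≟ₚ Cl = no λ ()
St ≟ₚ St = yes refl
St ≟ₚ Is = no λ ()
Is ≟ₚ Cl = no λ ()
Is ≟ₚ St = no λ ()
Is ≟ₚ Is = yes refl

byLabel : {A : Set} → Part → A → A → A → A
byLabel Cl c _ _ = c
byLabel St _ s _ = s
byLabel Is _ _ i = i

isLabel≡does : ∀ x y → isLabel x y ≡ does (y ≟ₚ x)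
isLabel≡does Cl Cl = refl
isLabel≡does Cl St = refl
isLabel≡does Cl Is = refl
isLabel≡does St Cl = refl
isLabel≡does St St = refl
isLabel≡does St Is = refl
isLabel≡does Is Cl = refl
isLabel≡does Is St = refl
isLabel≡does Is Is = refl

count≡size : ∀ {n} x (lab : Fin n → Part) → count x lab ≡ size (λ v → lab v ≟ₚ x)
count≡size {zero}  x lab = refl
count≡size {suc n} x lab with isLabel x (lab zero) | lab zero ≟ₚ x | isLabel≡does x (lab zero)
... | true  | yes _ | _ = cong suc (count≡size x (lab ∘ suc))
... | false | no _  | _ = count≡size x (lab ∘ suc)

size-labels : ∀ {n} (lab : Fin n → Part) →
              size (λ v → lab v ≟ₚ Cl) + size (λ v → lab v ≟ₚ St) + size (λ v → lab v ≟ₚ Is) ≡ n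
size-labels {zero}  lab = refl
size-labels {suc n} lab with lab zero | size-labels (lab ∘ suc)
... | Cl | ih = cong suc ih
... | St | ih = trans (cong (_+ size (λ v → lab (suc v) ≟ₚ Is)) (+-suc _ _)) (cong suc ih)
... | Is | ih = trans (+-suc _ _) (cong suc ih)

module PseudoSplitGraph {n} (G : Graph n) (lab : Fin n → Part) (ps : IsPseudoSplitPartition G lab) where

  labelled-≢ : ∀ {v x y} → lab v ≡ x → x ≢ y → lab v ≢ y
  labelled-≢ lv x≢y lv′ = x≢y (trans (≡.sym lv) lv′)

  label-≢ : ∀ {u v x y} → lab u ≡ x → lab v ≡ y → x ≢ y → u ≢ v
  label-≢ lu lv x≢y refl = labelled-≢ lu x≢y lv

  C-clique : ∀ {u v} → lab u ≡ Cl → lab v ≡ Cl → u ≢ v → adj G u v ≡ true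
  C-clique lu lv = proj₁ ps _ _ lu lv

  I-independent : ∀ {u v} → lab u ≡ Is → lab v ≡ Is → adj G u v ≡ false
  I-independent lu lv = Bool.¬-not (proj₁ (proj₂ ps) _ _ lu lv)

  C-complete-S : ∀ {u v} → lab u ≡ Cl → lab v ≡ St → adj G u v ≡ true
  C-complete-S lu lv = proj₁ (proj₂ (proj₂ (proj₂ ps))) _ _ lu lv

  S-complete-C : ∀ {u v} → lab u ≡ St → lab v ≡ Cl → adj G u v ≡ true
  S-complete-C lu lv = trans (sym G _ _) (C-complete-S lv lu)

  I-anticomplete-S : ∀ {u v} → lab u ≡ Is → lab v ≡ St → adj G u v ≡ false
  I-anticomplete-S lu lv = Bool.¬-not (proj₂ (proj₂ (proj₂ (proj₂ ps))) _ _ lu lv)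

  S-anticomplete-I : ∀ {u v} → lab u ≡ St → lab v ≡ Is → adj G u v ≡ false
  S-anticomplete-I lu lv = trans (sym G _ _) (I-anticomplete-S lv lu)

  Class : Part → Pred (Fin n) 0ℓ → Pred (Fin n) 0ℓ
  Class x Alive v = lab v ≡ x × Alive v

  CSeesI IMissesC : Pred (Fin n) 0ℓ → Pred (Fin n) 0ℓ
  CSeesI   Alive c = Class Cl Alive c × ∃ λ x → Class Is Alive x × Edge G c x
  IMissesC Alive x = Class Is Alive x × ∃ λ c → Class Cl Alive c × adj G x c ≡ false

  module _ {Alive : Pred (Fin n) 0ℓ} (Alive? : Decidable Alive) where

    opaque
      Class? : ∀ x → Decidable (Class x Alive)
      Class? x v = (lab v ≟ₚ x) ×-dec Alive? v

      CSeesI? : Decidable (CSeesI Alive)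
      CSeesI? c = Class? Cl c ×-dec any? (λ x → Class? Is x ×-dec (adj G c x Bool.≟ true))

      IMissesC? : Decidable (IMissesC Alive)
      IMissesC? x = Class? Is x ×-dec any? (λ c → Class? Cl c ×-dec (adj G x c Bool.≟ false))

    -- Bounds A is what a polar partition of the alive vertices forces when an edge of the 5-cycle
    -- lies in A, bounds B what it forces when a non-edge lies in B.
    BoundsA BoundsB : ℕ → ℕ → Set
    BoundsA s k = suc (size (Class? Is)) ≤ k × 2 + size CSeesI? ≤ s
    BoundsB s k = suc (size (Class? Cl)) ≤ s × 2 + size IMissesC? ≤ k

  size-Class-U : ∀ x → size (Class? U? x) ≡ size (λ v → lab v ≟ₚ x)
  size-Class-U x = size-cong (Class? U? x) (λ v → lab v ≟ₚ x) proj₁ (λ l → l , _)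

  count≡size-Class : ∀ x → count x lab ≡ size (Class? U? x)
  count≡size-Class x = trans (count≡size x lab) (≡.sym (size-Class-U x))

  size-Class-without : ∀ {x v} → lab v ≡ x → suc (size (Class? (∁? (v ≟_)) x)) ≡ size (Class? U? x)
  size-Class-without {x} {v} lv =
    trans (cong suc (size-cong (Class? (∁? (v ≟_)) x) (Class? U? x ∩? ∁? (v ≟_))
                               (λ (l , v≢) → (l , _) , v≢) (λ ((l , _) , v≢) → l , v≢)))
          (size-remove (Class? U? x) (lv , _))

  size-Class-without-other : ∀ {x v} → lab v ≢ x → size (Class? (∁? (v ≟_)) x) ≡ size (Class? U? x)
  size-Class-without-other {x} {v} lv≢x = size-cong (Class? (∁? (v ≟_)) x) (Class? U? x)
    (λ (l , _) → l , _) (λ (l , _) → l , λ { refl → lv≢x l })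

  split-polarOn : ∀ {s k} → (∀ v → lab v ≢ St) → 0 < s → 0 < k → PolarOn s k G U
  split-polarOn {s} {k} no-S s>0 k>0 = record
    { inA = λ v → does (lab v ≟ₚ Is) ; part = λ _ → 0 ; comp = λ _ → 0 ; part< = λ _ _ → s>0 ; comp< = λ _ _ → k>0
    ; multipartite = λ {u} {v} _ _ iu iv _ → I-independent (does-true⇒ (lab u ≟ₚ Is) iu) (does-true⇒ (lab v ≟ₚ Is) iv)
    ; cluster      = λ {u} {v} _ _ iu iv u≢v → C-clique (in-C u iu) (in-C v iv) u≢v }
    where
    in-C : ∀ v → does (lab v ≟ₚ Is) ≡ false → lab v ≡ Cl
    in-C v iv with lab v in lv
    ... | Cl = refl
    ... | St = contradiction lv (no-S v)

  module Analysis {s k} {Alive : Pred (Fin n) 0ℓ} (Alive? : Decidable Alive)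
                  (S-alive : ∀ {v} → lab v ≡ St → Alive v) (P : PolarOn s k G Alive) where
    open PolarOn P

    edgeInA⇒boundsA : ∀ {a₁ a₂ b} → lab a₁ ≡ St → lab a₂ ≡ St → lab b ≡ St →
                      inA a₁ ≡ true → inA a₂ ≡ true → inA b ≡ false → Edge G a₁ a₂ → BoundsA Alive? s k
    edgeInA⇒boundsA {a₁} {a₂} {b} l₁ l₂ lb i₁ i₂ ib e₁₂ = I-bound , CSeesI-bound
      where
      I-in-B : ∀ {x} → Class Is Alive x → inA x ≡ false
      I-in-B (lx , ax) = Bool.¬-not λ ix → no-coP3-in-A (S-alive l₁) (S-alive l₂) ax i₁ i₂ ix e₁₂
        (label-≢ lx l₁ λ ()) (label-≢ lx l₂ λ ()) (I-anticomplete-S lx l₁) (I-anticomplete-S lx l₂)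

      CSeesI-in-A : ∀ {c} → CSeesI Alive c → inA c ≡ true
      CSeesI-in-A ((lc , ac) , x , (lx , ax) , ecx) = Bool.¬-not λ ic → no-P3-in-B ax ac (S-alive lb)
        (I-in-B (lx , ax)) ic ib (trans (sym G _ _) ecx) (C-complete-S lc lb) (label-≢ lx lb λ ()) (I-anticomplete-S lx lb)

      I-bound : suc (size (Class? Alive? Is)) ≤ k
      I-bound = subst (_≤ k) (size-insert (Class? Alive? Is) (labelled-≢ lb (λ ()) ∘ proj₁))
        (independent⇒size≤ (Class? Alive? Is ∪? (b ≟_))
          [ proj₂ , (λ { refl → S-alive lb }) ]′ [ I-in-B , (λ { refl → ib }) ]′
          (independent-insert {G = G} (λ (lu , _) (lv , _) _ → I-independent lu lv) (λ (lu , _) → I-anticomplete-S lu lb)))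

      CSeesI-bound : 2 + size (CSeesI? Alive?) ≤ s
      CSeesI-bound = subst (_≤ s)
        (size-insert₂ (CSeesI? Alive?) (labelled-≢ l₁ (λ ()) ∘ proj₁ ∘ proj₁) (labelled-≢ l₂ (λ ()) ∘ proj₁ ∘ proj₁)
                      (edge⇒≢ G e₁₂))
        (clique⇒size≤ ((CSeesI? Alive? ∪? (a₁ ≟_)) ∪? (a₂ ≟_))
          [ [ proj₂ ∘ proj₁ , (λ { refl → S-alive l₁ }) ]′ , (λ { refl → S-alive l₂ }) ]′
          [ [ CSeesI-in-A , (λ { refl → i₁ }) ]′ , (λ { refl → i₂ }) ]′
          (clique-insert {G = G} (clique-insert {G = G} (λ ((lu , _) , _) ((lv , _) , _) → C-clique lu lv)
                                                          (λ ((lu , _) , _) → C-complete-S lu l₁))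
                                 [ (λ ((lu , _) , _) → C-complete-S lu l₂) , (λ { refl → e₁₂ }) ]′))

    nonEdgeInB⇒boundsB : ∀ {a b₁ b₂} → lab a ≡ St → lab b₁ ≡ St → lab b₂ ≡ St →
                         inA a ≡ true → inA b₁ ≡ false → inA b₂ ≡ false → b₁ ≢ b₂ → adj G b₁ b₂ ≡ false →
                         BoundsB Alive? s k
    nonEdgeInB⇒boundsB {a} {b₁} {b₂} la l₁ l₂ ia i₁ i₂ b₁≢b₂ e₁₂ = C-bound , IMissesC-bound
      where
      C-in-A : ∀ {c} → Class Cl Alive c → inA c ≡ true
      C-in-A (lc , ac) = Bool.¬-not λ ic → no-P3-in-B (S-alive l₁) ac (S-alive l₂) i₁ ic i₂
        (S-complete-C l₁ lc) (C-complete-S lc l₂) b₁≢b₂ e₁₂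

      IMissesC-in-B : ∀ {x} → IMissesC Alive x → inA x ≡ false
      IMissesC-in-B ((lx , ax) , c , (lc , ac) , exc) = Bool.¬-not λ ix → no-coP3-in-A ac (S-alive la) ax
        (C-in-A (lc , ac)) ia ix (C-complete-S lc la) (label-≢ lx lc λ ()) (label-≢ lx la λ ()) exc (I-anticomplete-S lx la)

      C-bound : suc (size (Class? Alive? Cl)) ≤ s
      C-bound = subst (_≤ s) (size-insert (Class? Alive? Cl) (labelled-≢ la (λ ()) ∘ proj₁))
        (clique⇒size≤ (Class? Alive? Cl ∪? (a ≟_))
          [ proj₂ , (λ { refl → S-alive la }) ]′ [ C-in-A , (λ { refl → ia }) ]′
          (clique-insert {G = G} (λ (lu , _) (lv , _) → C-clique lu lv) (λ (lu , _) → C-complete-S lu la)))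

      IMissesC-bound : 2 + size (IMissesC? Alive?) ≤ k
      IMissesC-bound = subst (_≤ k)
        (size-insert₂ (IMissesC? Alive?) (labelled-≢ l₁ (λ ()) ∘ proj₁ ∘ proj₁) (labelled-≢ l₂ (λ ()) ∘ proj₁ ∘ proj₁)
                      b₁≢b₂)
        (independent⇒size≤ ((IMissesC? Alive? ∪? (b₁ ≟_)) ∪? (b₂ ≟_))
          [ [ proj₂ ∘ proj₁ , (λ { refl → S-alive l₁ }) ]′ , (λ { refl → S-alive l₂ }) ]′
          [ [ IMissesC-in-B , (λ { refl → i₁ }) ]′ , (λ { refl → i₂ }) ]′
          (independent-insert {G = G} (independent-insert {G = G} (λ ((lu , _) , _) ((lv , _) , _) _ → I-independent lu lv)
                                                                  (λ ((lu , _) , _) → I-anticomplete-S lu l₁))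
                                      [ (λ ((lu , _) , _) → I-anticomplete-S lu l₂) , (λ { refl → e₁₂ }) ]′))

  module WithC5 (F : InducesC5 G lab) where

    f : Fin 5 → Fin n
    f = proj₁ F

    f-≢ : ∀ {i j} → i ≢ j → f i ≢ f j
    f-≢ i≢j = i≢j ∘ proj₁ (proj₂ F)

    f-St : ∀ i → lab (f i) ≡ St
    f-St = proj₁ (proj₂ (proj₂ F))

    f-onto : ∀ v → lab v ≡ St → ∃ λ i → f i ≡ v
    f-onto = proj₁ (proj₂ (proj₂ (proj₂ F)))

    f-adj : ∀ i j → adj G (f i) (f j) ≡ c5adj i j
    f-adj = proj₂ (proj₂ (proj₂ (proj₂ F)))

    index : Fin n → Fin 5
    index v with any? (λ i → f i ≟ v)
    ... | yes (i , _) = i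
    ... | no _        = zero

    f-index : ∀ {v} → lab v ≡ St → f (index v) ≡ v
    f-index {v} lv with any? (λ i → f i ≟ v)
    ... | yes (_ , fi≡v) = fi≡v
    ... | no none        = contradiction (f-onto v lv) none

    adj-S : ∀ {u v} → lab u ≡ St → lab v ≡ St → adj G u v ≡ c5adj (index u) (index v)
    adj-S lu lv = trans (cong₂ (adj G) (≡.sym (f-index lu)) (≡.sym (f-index lv))) (f-adj _ _)

    index-≢ : ∀ {u v} → lab u ≡ St → lab v ≡ St → u ≢ v → index u ≢ index v
    index-≢ lu lv u≢v eq = u≢v (trans (≡.sym (f-index lu)) (trans (cong f eq) (f-index lv)))

    polarOn⇒bounds : ∀ {s k} {Alive : Pred (Fin n) 0ℓ} (Alive? : Decidable Alive) → (∀ {v} → lab v ≡ St → Alive v) →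
                     PolarOn s k G Alive → BoundsA Alive? s k ⊎ BoundsB Alive? s k
    polarOn⇒bounds Alive? S-alive P with c5-shape (PolarOn.inA P ∘ f)
    ... | inj₁ (i , j , l , ii , ij , il , e) =
      inj₁ (edgeInA⇒boundsA (f-St i) (f-St j) (f-St l) ii ij il (trans (f-adj i j) e))
      where open Analysis Alive? S-alive P
    ... | inj₂ (inj₁ (i , j , l , ii , ij , il , j≢l , e)) =
      inj₂ (nonEdgeInB⇒boundsB (f-St i) (f-St j) (f-St l) ii ij il (f-≢ j≢l) (trans (f-adj j l) e))
      where open Analysis Alive? S-alive P
    ... | inj₂ (inj₂ (inj₁ (i , j , l , ii , ij , il , eij , l≢i , l≢j , eli , elj))) =
      ⊥-elim (no-coP3-in-A (S-alive (f-St i)) (S-alive (f-St j)) (S-alive (f-St l)) ii ij il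
        (trans (f-adj i j) eij) (f-≢ l≢i) (f-≢ l≢j) (trans (f-adj l i) eli) (trans (f-adj l j) elj))
      where open PolarOn P
    ... | inj₂ (inj₂ (inj₂ (i , j , l , ii , ij , il , eij , ejl , i≢l , eil))) =
      ⊥-elim (no-P3-in-B (S-alive (f-St i)) (S-alive (f-St j)) (S-alive (f-St l)) ii ij il
        (trans (f-adj i j) eij) (trans (f-adj j l) ejl) (f-≢ i≢l) (trans (f-adj i l) eil))
      where open PolarOn P

    boundsA⇒polarOn : ∀ {s k} {Alive : Pred (Fin n) 0ℓ} (Alive? : Decidable Alive) →
                      BoundsA Alive? s k → PolarOn s k G Alive
    boundsA⇒polarOn {s} {k} {Alive} Alive? (I-bound , CSeesI-bound) = record
      { inA = inA ; part = part ; comp = comp ; part< = part< ; comp< = comp<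
      ; multipartite = multipartite ; cluster = cluster }
      where
      inA : Fin n → Bool
      inA v = byLabel (lab v) (does (CSeesI? Alive? v)) (inAα (index v)) false
      part comp : Fin n → ℕ
      part v = byLabel (lab v) (2 + rank (CSeesI? Alive?) v) (partα (index v)) 0
      comp v = byLabel (lab v) 0 0 (suc (rank (Class? Alive? Is) v))

      sees : ∀ {c} → does (CSeesI? Alive? c) ≡ true → CSeesI Alive c
      sees = does-true⇒ (CSeesI? Alive? _)

      unseen : ∀ {c x} → lab c ≡ Cl → Alive c → lab x ≡ Is → Alive x →
               does (CSeesI? Alive? c) ≡ false → adj G c x ≡ false
      unseen lc ac lx ax ¬sees = Bool.¬-not λ e → does-false⇒ (CSeesI? Alive? _) ¬sees ((lc , ac) , _ , (lx , ax) , e)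

      C≢S-part : ∀ {c i} → 2 + rank (CSeesI? Alive?) c ≢ partα i
      C≢S-part {i = i} eq with partα≤1 i
      ... | le rewrite ≡.sym eq = contradiction le λ { (s≤s ()) }

      part< : ∀ {v} → Alive v → inA v ≡ true → part v < s
      part< {v} av iv with lab v
      ... | Cl = ≤-trans (s≤s (s≤s (rank-< (CSeesI? Alive?) (sees iv)))) CSeesI-bound
      ... | St = ≤-trans (s≤s (partα≤1 _)) (≤-trans (s≤s (s≤s z≤n)) CSeesI-bound)

      comp< : ∀ {v} → Alive v → inA v ≡ false → comp v < k
      comp< {v} av iv with lab v in lv
      ... | Cl = ≤-trans (s≤s z≤n) I-bound
      ... | St = ≤-trans (s≤s z≤n) I-bound
      ... | Is = ≤-trans (s≤s (rank-< (Class? Alive? Is) (lv , av))) I-bound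

      multipartite : ∀ {u v} → Alive u → Alive v → inA u ≡ true → inA v ≡ true → u ≢ v →
                     adj G u v ≡ not (does (part u ℕ.≟ part v))
      multipartite {u} {v} au av iu iv u≢v with lab u in lu | lab v in lv
      ... | Cl | Cl = trans (C-clique lu lv u≢v)
                            (≡.sym (≢⇒not-does (u≢v ∘ rank-injective (CSeesI? Alive?) (sees iu) (sees iv)
                                                    ∘ suc-injective ∘ suc-injective)))
      ... | Cl | St = trans (C-complete-S lu lv) (≡.sym (≢⇒not-does (C≢S-part {u} {index v})))
      ... | St | Cl = trans (S-complete-C lu lv) (≡.sym (≢⇒not-does (C≢S-part {v} {index u} ∘ ≡.sym)))
      ... | St | St = trans (adj-S lu lv) (c5-α-multipartite _ _ (index-≢ lu lv u≢v) iu iv)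

      cluster : ∀ {u v} → Alive u → Alive v → inA u ≡ false → inA v ≡ false → u ≢ v →
                adj G u v ≡ does (comp u ℕ.≟ comp v)
      cluster {u} {v} au av iu iv u≢v with lab u in lu | lab v in lv
      ... | Cl | Cl = C-clique lu lv u≢v
      ... | Cl | St = C-complete-S lu lv
      ... | St | Cl = S-complete-C lu lv
      ... | St | St = trans (adj-S lu lv) (c5-α-cluster _ _ (index-≢ lu lv u≢v) iu iv)
      ... | Cl | Is = unseen lu au lv av iu
      ... | Is | Cl = trans (sym G u v) (unseen lv av lu au iv)
      ... | St | Is = S-anticomplete-I lu lv
      ... | Is | St = I-anticomplete-S lu lv
      ... | Is | Is = trans (I-independent lu lv)
                            (≡.sym (dec-false (_ ℕ.≟ _)
                              (u≢v ∘ rank-injective (Class? Alive? Is) (lu , au) (lv , av) ∘ suc-injective)))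

    boundsB⇒polarOn : ∀ {s k} {Alive : Pred (Fin n) 0ℓ} (Alive? : Decidable Alive) →
                      BoundsB Alive? s k → PolarOn s k G Alive
    boundsB⇒polarOn {s} {k} {Alive} Alive? (C-bound , IMissesC-bound) = record
      { inA = inA ; part = part ; comp = comp ; part< = part< ; comp< = comp<
      ; multipartite = multipartite ; cluster = cluster }
      where
      inA : Fin n → Bool
      inA v = byLabel (lab v) true (inAβ (index v)) (not (does (IMissesC? Alive? v)))
      part comp : Fin n → ℕ
      part v = byLabel (lab v) (suc (rank (Class? Alive? Cl) v)) 0 0
      comp v = byLabel (lab v) 0 (compβ (index v)) (2 + rank (IMissesC? Alive?) v)

      misses : ∀ {x} → not (does (IMissesC? Alive? x)) ≡ false → IMissesC Alive x
      misses = does-true⇒ (IMissesC? Alive? _) ∘ Bool.not-injective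

      complete : ∀ {x c} → lab x ≡ Is → Alive x → lab c ≡ Cl → Alive c →
                 not (does (IMissesC? Alive? x)) ≡ true → adj G x c ≡ true
      complete lx ax lc ac ¬misses = Bool.¬-not λ e →
        does-false⇒ (IMissesC? Alive? _) (Bool.not-injective ¬misses) ((lx , ax) , _ , (lc , ac) , e)

      S≢I-comp : ∀ {i x} → compβ i ≢ 2 + rank (IMissesC? Alive?) x
      S≢I-comp {i} eq with compβ≤1 i
      ... | le rewrite eq = contradiction le λ { (s≤s ()) }

      part< : ∀ {v} → Alive v → inA v ≡ true → part v < s
      part< {v} av iv with lab v in lv
      ... | Cl = ≤-trans (s≤s (rank-< (Class? Alive? Cl) (lv , av))) C-bound
      ... | St = ≤-trans (s≤s z≤n) C-bound
      ... | Is = ≤-trans (s≤s z≤n) C-bound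

      comp< : ∀ {v} → Alive v → inA v ≡ false → comp v < k
      comp< {v} av iv with lab v
      ... | St = ≤-trans (s≤s (compβ≤1 _)) (≤-trans (s≤s (s≤s z≤n)) IMissesC-bound)
      ... | Is = ≤-trans (s≤s (s≤s (rank-< (IMissesC? Alive?) (misses iv)))) IMissesC-bound

      multipartite : ∀ {u v} → Alive u → Alive v → inA u ≡ true → inA v ≡ true → u ≢ v →
                     adj G u v ≡ not (does (part u ℕ.≟ part v))
      multipartite {u} {v} au av iu iv u≢v with lab u in lu | lab v in lv
      ... | Cl | Cl = trans (C-clique lu lv u≢v)
                            (≡.sym (≢⇒not-does (u≢v ∘ rank-injective (Class? Alive? Cl) (lu , au) (lv , av) ∘ suc-injective)))
      ... | Cl | St = C-complete-S lu lv
      ... | St | Cl = S-complete-C lu lv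
      ... | Cl | Is = trans (sym G u v) (complete lv av lu au iv)
      ... | Is | Cl = complete lu au lv av iu
      ... | St | St = trans (adj-S lu lv) (c5-β-multipartite _ _ (index-≢ lu lv u≢v) iu iv)
      ... | St | Is = S-anticomplete-I lu lv
      ... | Is | St = I-anticomplete-S lu lv
      ... | Is | Is = I-independent lu lv

      cluster : ∀ {u v} → Alive u → Alive v → inA u ≡ false → inA v ≡ false → u ≢ v →
                adj G u v ≡ does (comp u ℕ.≟ comp v)
      cluster {u} {v} au av iu iv u≢v with lab u in lu | lab v in lv
      ... | St | St = trans (adj-S lu lv) (c5-β-cluster _ _ (index-≢ lu lv u≢v) iu iv)
      ... | St | Is = trans (S-anticomplete-I lu lv) (≡.sym (dec-false (_ ℕ.≟ _) (S≢I-comp {index u} {v})))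
      ... | Is | St = trans (I-anticomplete-S lu lv) (≡.sym (dec-false (_ ℕ.≟ _) (S≢I-comp {index v} {u} ∘ ≡.sym)))
      ... | Is | Is = trans (I-independent lu lv) (≡.sym (dec-false (_ ℕ.≟ _)
                        (u≢v ∘ rank-injective (IMissesC? Alive?) (misses iu) (misses iv) ∘ suc-injective ∘ suc-injective)))

    polarOn-without-S : ∀ {s k v₀} → lab v₀ ≡ St → 0 < s → 0 < k → PolarOn s k G (∁ ｛ v₀ ｝)
    polarOn-without-S {s} {k} {v₀} l₀ s>0 k>0 = record
      { inA = inA ; part = λ _ → 0 ; comp = λ _ → 0 ; part< = λ _ _ → s>0 ; comp< = λ _ _ → k>0
      ; multipartite = multipartite ; cluster = cluster }
      where
      inA : Fin n → Bool
      inA v = byLabel (lab v) false (c5adj (index v₀) (index v)) true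

      multipartite : ∀ {u v} → v₀ ≢ u → v₀ ≢ v → inA u ≡ true → inA v ≡ true → u ≢ v → adj G u v ≡ false
      multipartite {u} {v} _ _ iu iv u≢v with lab u in lu | lab v in lv
      ... | St | St = trans (adj-S lu lv) (c5-neighbours-nonadjacent _ _ _ (index-≢ lu lv u≢v) iu iv)
      ... | St | Is = S-anticomplete-I lu lv
      ... | Is | St = I-anticomplete-S lu lv
      ... | Is | Is = I-independent lu lv

      cluster : ∀ {u v} → v₀ ≢ u → v₀ ≢ v → inA u ≡ false → inA v ≡ false → u ≢ v → adj G u v ≡ true
      cluster {u} {v} v₀≢u v₀≢v iu iv u≢v with lab u in lu | lab v in lv
      ... | Cl | Cl = C-clique lu lv u≢v
      ... | Cl | St = C-complete-S lu lv
      ... | St | Cl = S-complete-C lu lv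
      ... | St | St = trans (adj-S lu lv) (c5-non-neighbours-adjacent _ _ _
                        (index-≢ lu l₀ (v₀≢u ∘ ≡.sym)) (index-≢ lv l₀ (v₀≢v ∘ ≡.sym)) (index-≢ lu lv u≢v) iu iv)

-- Minimal obstructions

module Obstruction {s k n} (s≥2 : 2 ≤ s) (k≥2 : 2 ≤ k) (G : Graph n) (lab : Fin n → Part)
                   (ps : IsPseudoSplitPartition G lab) (obstruction : MinimalObstruction s k G) where
  open PseudoSplitGraph G lab ps

  s>0 : 0 < s
  s>0 = ≤-trans (s≤s z≤n) s≥2

  k>0 : 0 < k
  k>0 = ≤-trans (s≤s z≤n) k≥2

  instance
    s-nonZero : NonZero s
    s-nonZero = >-nonZero s>0
    k-nonZero : NonZero k
    k-nonZero = >-nonZero k>0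

  S-induces-C5 : InducesC5 G lab
  S-induces-C5 with proj₁ (proj₂ (proj₂ ps))
  ... | inj₁ no-S = contradiction (polarOn-U⇒polar (split-polarOn no-S s>0 k>0)) (obstruction⇒¬polar obstruction)
  ... | inj₂ F    = F

  open WithC5 S-induces-C5

  #C #I : ℕ
  #C = size (Class? U? Cl)
  #I = size (Class? U? Is)

  ¬boundsA : ¬ BoundsA U? s k
  ¬boundsA = obstruction⇒¬polar obstruction ∘ polarOn-U⇒polar ∘ boundsA⇒polarOn U?

  ¬boundsB : ¬ BoundsB U? s k
  ¬boundsB = obstruction⇒¬polar obstruction ∘ polarOn-U⇒polar ∘ boundsB⇒polarOn U?

  bounds-without : ∀ {v} → lab v ≢ St → BoundsA (∁? (v ≟_)) s k ⊎ BoundsB (∁? (v ≟_)) s k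
  bounds-without {v} lv≢St = polarOn⇒bounds (∁? (v ≟_)) (λ lu v≡u → lv≢St (trans (cong lab v≡u) lu))
                                            (obstruction⇒polarOn-─ obstruction v)

  boundsA-without-C : s < #C → ∀ {c} → lab c ≡ Cl → BoundsA (∁? (c ≟_)) s k
  boundsA-without-C s<#C lc with bounds-without (labelled-≢ lc λ ())
  ... | inj₁ boundsA       = boundsA
  ... | inj₂ (C-bound , _) = contradiction (subst (_≤ s) (size-Class-without lc) C-bound) (<⇒≱ s<#C)

  boundsB-without-I : k < #I → ∀ {y} → lab y ≡ Is → BoundsB (∁? (y ≟_)) s k
  boundsB-without-I k<#I ly with bounds-without (labelled-≢ ly λ ())
  ... | inj₂ boundsB       = boundsB
  ... | inj₁ (I-bound , _) = contradiction (subst (_≤ k) (size-Class-without ly) I-bound) (<⇒≱ k<#I)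

  -- If s < |C|, bounds A for G − c₁ leave fewer C-vertices seeing I than there are in C − c₁.
  C-vertex-without-I-neighbour : s < #C → ∃ λ c → lab c ≡ Cl × (∀ {x} → lab x ≡ Is → adj G c x ≡ false)
  C-vertex-without-I-neighbour s<#C =
    let c₁ , lc₁ , _ = size-positive⇒∃ (Class? U? Cl) (≤-<-trans z≤n s<#C)
        gap : size (CSeesI? (∁? (c₁ ≟_))) < size (Class? (∁? (c₁ ≟_)) Cl)
        gap = ≤-trans (n≤1+n _) (≤-pred (≤-trans (s≤s (proj₂ (boundsA-without-C s<#C lc₁)))
                                                 (subst (suc s ≤_) (≡.sym (size-Class-without lc₁)) s<#C)))
        c₂ , (lc₂ , c₁≢c₂) , c₂-unseen = size-<⇒∃ (CSeesI? (∁? (c₁ ≟_))) (Class? (∁? (c₁ ≟_)) Cl) gap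
    in c₂ , lc₂ , λ lx → Bool.¬-not λ e → c₂-unseen ((lc₂ , c₁≢c₂) , _ , (lx , label-≢ lc₁ lx λ ()) , e)

  I-vertex-complete-to-C : k < #I → ∃ λ y → lab y ≡ Is × (∀ {c} → lab c ≡ Cl → Edge G y c)
  I-vertex-complete-to-C k<#I =
    let y₁ , ly₁ , _ = size-positive⇒∃ (Class? U? Is) (≤-<-trans z≤n k<#I)
        gap : size (IMissesC? (∁? (y₁ ≟_))) < size (Class? (∁? (y₁ ≟_)) Is)
        gap = ≤-trans (n≤1+n _) (≤-pred (≤-trans (s≤s (proj₂ (boundsB-without-I k<#I ly₁)))
                                                 (subst (suc k ≤_) (≡.sym (size-Class-without ly₁)) k<#I)))
        y₂ , (ly₂ , y₁≢y₂) , y₂-complete = size-<⇒∃ (IMissesC? (∁? (y₁ ≟_))) (Class? (∁? (y₁ ≟_)) Is) gap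
    in y₂ , ly₂ , λ lc → Bool.¬-not λ e → y₂-complete ((ly₂ , y₁≢y₂) , _ , (lc , label-≢ ly₁ lc λ ()) , e)

  -- For such a c, bounds A for G − c imply bounds A for G (dually for I). Opaque for the same
  -- reason as c5-shape.
  opaque
    C-bounded : #C ≤ s
    C-bounded = ≮⇒≥ λ s<#C →
      let c , lc , no-I-neighbour = C-vertex-without-I-neighbour s<#C
          I-bound , CSeesI-bound = boundsA-without-C s<#C lc
          seen-⊆ : CSeesI U ⊆ CSeesI (∁ ｛ c ｝)
          seen-⊆ = λ ((lc′ , _) , x , (lx , _) , e) →
            (lc′ , λ { refl → contradiction (trans (≡.sym e) (no-I-neighbour lx)) λ () }) , x , (lx , label-≢ lc lx λ ()) , e
      in ¬boundsA ( subst (λ m → suc m ≤ k) (size-Class-without-other (labelled-≢ lc λ ())) I-bound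
                  , ≤-trans (s≤s (s≤s (size-mono (CSeesI? U?) (CSeesI? (∁? (c ≟_))) seen-⊆))) CSeesI-bound )

    I-bounded : #I ≤ k
    I-bounded = ≮⇒≥ λ k<#I →
      let y , ly , complete = I-vertex-complete-to-C k<#I
          C-bound , IMissesC-bound = boundsB-without-I k<#I ly
          misses-⊆ : IMissesC U ⊆ IMissesC (∁ ｛ y ｝)
          misses-⊆ = λ ((ly′ , _) , c , (lc , _) , e) →
            (ly′ , λ { refl → contradiction (trans (≡.sym e) (complete lc)) λ () }) , c , (lc , label-≢ ly lc λ ()) , e
      in ¬boundsB ( subst (λ m → suc m ≤ s) (size-Class-without-other (labelled-≢ ly λ ())) C-bound
                  , ≤-trans (s≤s (s≤s (size-mono (IMissesC? U?) (IMissesC? (∁? (y ≟_))) misses-⊆))) IMissesC-bound )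

  I-pair-complete-to-C-but : ∀ {c} → lab c ≡ Cl → 2 + size (IMissesC? (∁? (c ≟_))) ≤ #I →
                             ∃₂ λ y₁ y₂ → lab y₁ ≡ Is × y₁ ≢ y₂ × lab y₂ ≡ Is ×
                                          (∀ {c′} → lab c′ ≡ Cl → c ≢ c′ → Edge G y₂ c′)
  I-pair-complete-to-C-but {c} lc IMissesC-bound =
    let y₁ , (ly₁ , _) , _ = size-<⇒∃ (IMissesC? (∁? (c ≟_))) (Class? U? Is) (≤-trans (n≤1+n _) IMissesC-bound)
        y₂ , (ly₂ , y₁≢y₂) , y₂-complete = size-<⇒∃ (IMissesC? (∁? (c ≟_))) (Class? (∁? (y₁ ≟_)) Is)
          (≤-pred (subst (2 + size (IMissesC? (∁? (c ≟_))) ≤_) (≡.sym (size-Class-without ly₁)) IMissesC-bound))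
    in y₁ , y₂ , ly₁ , y₁≢y₂ , ly₂ , λ lc′ c≢c′ → Bool.¬-not λ e →
         y₂-complete ((ly₂ , label-≢ lc ly₂ λ ()) , _ , (lc′ , c≢c′) , e)

  C∖c-sees-I-bound : ∀ {c y₁ y₂} → lab c ≡ Cl → lab y₁ ≡ Is → y₁ ≢ y₂ → lab y₂ ≡ Is →
                     (∀ {c′} → lab c′ ≡ Cl → c ≢ c′ → Edge G y₂ c′) → #C ≤ suc (size (CSeesI? (∁? (y₁ ≟_))))
  C∖c-sees-I-bound {c} {y₁} {y₂} lc ly₁ y₁≢y₂ ly₂ complete =
    subst (_≤ suc (size (CSeesI? (∁? (y₁ ≟_))))) (size-Class-without lc)
          (s≤s (size-mono (Class? (∁? (c ≟_)) Cl) (CSeesI? (∁? (y₁ ≟_))) sees-y₂))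
    where
    sees-y₂ : Class Cl (∁ ｛ c ｝) ⊆ CSeesI (∁ ｛ y₁ ｝)
    sees-y₂ (lc′ , c≢c′) = (lc′ , label-≢ ly₁ lc′ λ ()) , y₂ , (ly₂ , y₁≢y₂) , trans (sym G _ _) (complete lc′ c≢c′)

  -- With |C| = s and |I| = k, bounds A fails for every G − c; bounds B for G − c yields two
  -- I-vertices y₁ ≠ y₂ with y₂ complete to C − c, and then neither bound holds for G − y₁.
  C-deletion-impossible : s ≤ #C → k ≤ #I → ∀ {c} → lab c ≡ Cl → ⊥
  C-deletion-impossible s≤#C k≤#I {c} lc = case bounds-without (labelled-≢ lc λ ()) of λ
    { (inj₁ (I-bound , _)) →
        <⇒≱ (subst (λ m → suc m ≤ k) (size-Class-without-other (labelled-≢ lc λ ())) I-bound) k≤#I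
    ; (inj₂ (_ , IMissesC-bound)) →
        let y₁ , y₂ , ly₁ , y₁≢y₂ , ly₂ , complete = I-pair-complete-to-C-but lc (≤-trans IMissesC-bound k≤#I) in
        case bounds-without (labelled-≢ ly₁ λ ()) of λ
          { (inj₁ (_ , CSeesI-bound)) →
              <-irrefl refl (≤-trans CSeesI-bound (≤-trans s≤#C (C∖c-sees-I-bound lc ly₁ y₁≢y₂ ly₂ complete)))
          ; (inj₂ (C-bound , _)) →
              <⇒≱ (subst (λ m → suc m ≤ s) (size-Class-without-other (labelled-≢ ly₁ λ ())) C-bound) s≤#C }
    }

  C+I-bounded : #C + #I ≤ s + k ∸ 1
  C+I-bounded = ∸-monoˡ-≤ 1 (≰⇒> λ tight →
    let s≤#C = +-cancelʳ-≤ k s #C (≤-trans tight (+-monoʳ-≤ #C I-bounded))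
        k≤#I = +-cancelˡ-≤ s k #I (≤-trans tight (+-monoˡ-≤ #I C-bounded))
        c , lc , _ = size-positive⇒∃ (Class? U? Cl) (≤-trans s>0 s≤#C)
    in C-deletion-impossible s≤#C k≤#I lc)

  S-bounded : size (Class? U? St) ≤ 5
  S-bounded = injection⇒size≤ (Class? U? St) (toℕ ∘ index) (λ _ → Fin.toℕ<n _)
    λ (lu , _) (lv , _) eq → trans (≡.sym (f-index lu)) (trans (cong f (Fin.toℕ-injective eq)) (f-index lv))

  imperfect : ∃ λ v → lab v ≡ St
  imperfect = f zero , f-St zero

  order-bounded : n ≤ s + k + 4
  order-bounded = begin
    n                                  ≡⟨ size-labels lab ⟨
    size-Cl + size-St + size-Is        ≡⟨ cong₂ (λ a b → a + size-St + b) (size-Class-U Cl) (size-Class-U Is) ⟨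
    #C + size-St + #I                  ≡⟨ +-assoc #C size-St #I ⟩
    #C + (size-St + #I)                ≡⟨ cong (#C +_) (+-comm size-St #I) ⟩
    #C + (#I + size-St)                ≡⟨ +-assoc #C #I size-St ⟨
    #C + #I + size-St                  ≤⟨ +-mono-≤ C+I-bounded (subst (_≤ 5) (size-Class-U St) S-bounded) ⟩
    s + k ∸ 1 + 5                      ≡⟨ pred+5≡+4 (≤-trans s>0 (m≤m+n s k)) ⟩
    s + k + 4                          ∎
    where
    open ≤-Reasoning
    size-Cl size-St size-Is : ℕ
    size-Cl = size (λ v → lab v ≟ₚ Cl)
    size-St = size (λ v → lab v ≟ₚ St)
    size-Is = size (λ v → lab v ≟ₚ Is)
    pred+5≡+4 : ∀ {m} → 1 ≤ m → m ∸ 1 + 5 ≡ m + 4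
    pred+5≡+4 {suc m} _ = +-suc m 4

-- The extremal graphs

data Kind : Set where
  kS : Fin 5 → Kind
  kC kI : Kind

kindLabel : Kind → Part
kindLabel (kS _) = St
kindLabel kC     = Cl
kindLabel kI     = Is

kindAdj : Bool → Kind → Kind → Bool
kindAdj e (kS i) (kS j) = c5adj i j
kindAdj e (kS _) kC     = true
kindAdj e kC     (kS _) = true
kindAdj e kC     kC     = true
kindAdj e kC     kI     = e
kindAdj e kI     kC     = e
kindAdj e (kS _) kI     = false
kindAdj e kI     (kS _) = false
kindAdj e kI     kI     = false

kindAdj-sym : ∀ e x y → kindAdj e x y ≡ kindAdj e y x
kindAdj-sym e (kS i) (kS j) = c5-sym i j
kindAdj-sym e (kS _) kC     = refl
kindAdj-sym e (kS _) kI     = refl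
kindAdj-sym e kC     (kS _) = refl
kindAdj-sym e kC     kC     = refl
kindAdj-sym e kC     kI     = refl
kindAdj-sym e kI     (kS _) = refl
kindAdj-sym e kI     kC     = refl
kindAdj-sym e kI     kI     = refl

-- A 5-cycle S, a clique C of size a complete to S, an independent set I of size b with no edges
-- to S, and all C–I pairs adjacent (e ≡ true) or all non-adjacent (e ≡ false).
module Extremal (a b : ℕ) (e : Bool) where

  kind : Fin (5 + (a + b)) → Kind
  kind v = [ kS , (λ w → [ (λ _ → kC) , (λ _ → kI) ]′ (splitAt a w)) ]′ (splitAt 5 v)

  G : Graph (5 + (a + b))
  G = record { adj = adjacency ; sym = adjacency-sym ; irrefl = adjacency-irrefl }
    where
    adjacency : Fin (5 + (a + b)) → Fin (5 + (a + b)) → Bool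
    adjacency u v = if does (u ≟ v) then false else kindAdj e (kind u) (kind v)
    adjacency-sym : ∀ u v → adjacency u v ≡ adjacency v u
    adjacency-sym u v with u ≟ v | v ≟ u
    ... | yes _   | yes _   = refl
    ... | no _    | no _    = kindAdj-sym e (kind u) (kind v)
    ... | yes u≡v | no v≢u  = contradiction (≡.sym u≡v) v≢u
    ... | no u≢v  | yes v≡u = contradiction (≡.sym v≡u) u≢v
    adjacency-irrefl : ∀ v → adjacency v v ≡ false
    adjacency-irrefl v with v ≟ v
    ... | yes _  = refl
    ... | no v≢v = contradiction refl v≢v

  adj-≢ : ∀ {u v} → u ≢ v → adj G u v ≡ kindAdj e (kind u) (kind v)
  adj-≢ {u} {v} u≢v with u ≟ v
  ... | yes u≡v = contradiction u≡v u≢v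
  ... | no _    = refl

  lab : Fin (5 + (a + b)) → Part
  lab = kindLabel ∘ kind

  sv : Fin 5 → Fin (5 + (a + b))
  sv i = i ↑ˡ (a + b)
  cv : Fin a → Fin (5 + (a + b))
  cv j = 5 ↑ʳ (j ↑ˡ b)
  iv : Fin b → Fin (5 + (a + b))
  iv j = 5 ↑ʳ (a ↑ʳ j)

  kind-sv : ∀ i → kind (sv i) ≡ kS i
  kind-sv i = cong [ kS , _ ]′ (Fin.splitAt-↑ˡ 5 i (a + b))

  kind-cv : ∀ j → kind (cv j) ≡ kC
  kind-cv j rewrite Fin.splitAt-↑ʳ 5 (a + b) (j ↑ˡ b) | Fin.splitAt-↑ˡ a j b = refl

  kind-iv : ∀ j → kind (iv j) ≡ kI
  kind-iv j rewrite Fin.splitAt-↑ʳ 5 (a + b) (a ↑ʳ j) | Fin.splitAt-↑ʳ a b j = refl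

  lab-sv : ∀ i → lab (sv i) ≡ St
  lab-sv i = cong kindLabel (kind-sv i)

  lab-cv : ∀ j → lab (cv j) ≡ Cl
  lab-cv j = cong kindLabel (kind-cv j)

  lab-iv : ∀ j → lab (iv j) ≡ Is
  lab-iv j = cong kindLabel (kind-iv j)

  data View : Fin (5 + (a + b)) → Set where
    S-vertex : ∀ i → View (sv i)
    C-vertex : ∀ j → View (cv j)
    I-vertex : ∀ j → View (iv j)

  view : ∀ v → View v
  view v = subst View (Fin.join-splitAt 5 (a + b) v) (view-join (splitAt 5 v))
    where
    view-CI : ∀ w → View (5 ↑ʳ join a b w)
    view-CI (inj₁ j) = C-vertex j
    view-CI (inj₂ j) = I-vertex j
    view-join : ∀ x → View (join 5 (a + b) x)
    view-join (inj₁ i) = S-vertex i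
    view-join (inj₂ w) = subst (View ∘ (5 ↑ʳ_)) (Fin.join-splitAt a b w) (view-CI (splitAt a w))

  kind-Cl : ∀ {v} → lab v ≡ Cl → kind v ≡ kC
  kind-Cl {v} lv with kind v
  ... | kC = refl

  kind-Is : ∀ {v} → lab v ≡ Is → kind v ≡ kI
  kind-Is {v} lv with kind v
  ... | kI = refl

  kind-St : ∀ {v} → lab v ≡ St → ∃ λ i → kind v ≡ kS i
  kind-St {v} lv with kind v
  ... | kS i = i , refl

  adj-by-label : ∀ {u v x y} → lab u ≡ x → lab v ≡ y → x ≢ y → adj G u v ≡ kindAdj e (kind u) (kind v)
  adj-by-label {u} {v} lu lv x≢y = adj-≢ {u} {v} λ { refl → x≢y (trans (≡.sym lu) lv) }

  C-I-adjacency : ∀ {c x} → lab c ≡ Cl → lab x ≡ Is → adj G c x ≡ e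
  C-I-adjacency {c} {x} lc lx =
    trans (adj-by-label {c} {x} lc lx λ ()) (cong₂ (kindAdj e) (kind-Cl {c} lc) (kind-Is {x} lx))

  I-C-adjacency : ∀ {x c} → lab x ≡ Is → lab c ≡ Cl → adj G x c ≡ e
  I-C-adjacency {x} {c} lx lc = trans (sym G x c) (C-I-adjacency {c} {x} lc lx)

  S-induces-C5 : InducesC5 G lab
  S-induces-C5 = sv , (λ {i} {j} → Fin.↑ˡ-injective (a + b) i j) , lab-sv , onto , sv-adj
    where
    onto : ∀ v → lab v ≡ St → ∃ λ i → sv i ≡ v
    onto v lv with view v
    ... | S-vertex i = i , refl
    ... | C-vertex j = contradiction (trans (≡.sym (lab-cv j)) lv) λ ()
    ... | I-vertex j = contradiction (trans (≡.sym (lab-iv j)) lv) λ ()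
    sv-adj : ∀ i j → adj G (sv i) (sv j) ≡ c5adj i j
    sv-adj i j with i Fin.≟ j
    ... | yes refl = trans (irrefl G (sv i)) (≡.sym (c5-irrefl i))
    ... | no i≢j   = trans (adj-≢ (i≢j ∘ Fin.↑ˡ-injective (a + b) i j)) (cong₂ (kindAdj e) (kind-sv i) (kind-sv j))

  pseudo-split : IsPseudoSplitPartition G lab
  pseudo-split = C-clique , I-independent , inj₂ S-induces-C5 , C-complete-S , I-anticomplete-S
    where
    C-clique : ∀ u v → lab u ≡ Cl → lab v ≡ Cl → u ≢ v → Edge G u v
    C-clique u v lu lv u≢v = trans (adj-≢ u≢v) (cong₂ (kindAdj e) (kind-Cl {u} lu) (kind-Cl {v} lv))
    I-independent : ∀ u v → lab u ≡ Is → lab v ≡ Is → ¬ Edge G u v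
    I-independent u v lu lv with u Fin.≟ v
    ... | yes refl = λ ()
    ... | no _     = λ edge →
      contradiction (trans (≡.sym edge) (cong₂ (kindAdj e) (kind-Is {u} lu) (kind-Is {v} lv))) λ ()
    C-complete-S : ∀ u v → lab u ≡ Cl → lab v ≡ St → Edge G u v
    C-complete-S u v lu lv with kind-St {v} lv
    ... | i , kv = trans (adj-by-label {u} {v} lu lv λ ()) (cong₂ (kindAdj e) (kind-Cl {u} lu) kv)
    I-anticomplete-S : ∀ u v → lab u ≡ Is → lab v ≡ St → ¬ Edge G u v
    I-anticomplete-S u v lu lv with kind-St {v} lv
    ... | i , kv = λ edge → contradiction
      (trans (≡.sym edge) (trans (adj-by-label {u} {v} lu lv λ ()) (cong₂ (kindAdj e) (kind-Is {u} lu) kv))) λ ()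

  open PseudoSplitGraph G lab pseudo-split public
  open WithC5 S-induces-C5 public

  size-by-kind : ∀ {P} (P? : Decidable P) → size P? ≡ size (P? ∘ sv) + (size (P? ∘ cv) + size (P? ∘ iv))
  size-by-kind P? = trans (size-↑ 5 P?) (cong (size (P? ∘ sv) +_) (size-↑ a (P? ∘ (5 ↑ʳ_))))

  #C≡a : size (Class? U? Cl) ≡ a
  #C≡a = trans (size-by-kind (Class? U? Cl))
    (trans (cong₂ (λ x y → x + (y + size (Class? U? Cl ∘ iv)))
                  (size-none (Class? U? Cl ∘ sv) λ i (l , _) → contradiction (trans (≡.sym (lab-sv i)) l) λ ())
                  (size-all (Class? U? Cl ∘ cv) λ j → lab-cv j , _))
           (trans (cong (a +_) (size-none (Class? U? Cl ∘ iv)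
                                    λ j (l , _) → contradiction (trans (≡.sym (lab-iv j)) l) λ ()))
                  (+-identityʳ a)))

  #I≡b : size (Class? U? Is) ≡ b
  #I≡b = trans (size-by-kind (Class? U? Is))
    (trans (cong₂ (λ x y → x + (y + size (Class? U? Is ∘ iv)))
                  (size-none (Class? U? Is ∘ sv) λ i (l , _) → contradiction (trans (≡.sym (lab-sv i)) l) λ ())
                  (size-none (Class? U? Is ∘ cv) λ j (l , _) → contradiction (trans (≡.sym (lab-cv j)) l) λ ()))
           (size-all (Class? U? Is ∘ iv) λ j → lab-iv j , _))

module ExtremalS2 (k : ℕ) (k≥2 : 2 ≤ k) where
  open Extremal 1 k false

  k>0 : 0 < k
  k>0 = ≤-trans (s≤s z≤n) k≥2

  instance
    k-nonZero : NonZero k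
    k-nonZero = >-nonZero k>0

  unique-C : ∀ {u v} → lab u ≡ Cl → lab v ≡ Cl → u ≡ v
  unique-C {u} {v} lu lv = trans (the-C lu) (≡.sym (the-C lv))
    where
    the-C : ∀ {w} → lab w ≡ Cl → w ≡ cv zero
    the-C {w} lw with view w
    ... | S-vertex i    = contradiction (trans (≡.sym (lab-sv i)) lw) λ ()
    ... | C-vertex zero = refl
    ... | I-vertex j    = contradiction (trans (≡.sym (lab-iv j)) lw) λ ()

  ¬polar : ¬ Polar 2 k G
  ¬polar P = [ ¬boundsA , ¬boundsB ]′ (polarOn⇒bounds U? (λ _ → _) (polar⇒polarOn P))
    where
    ¬boundsA : ¬ BoundsA U? 2 k
    ¬boundsA (I-bound , _) = <-irrefl refl (subst (λ m → suc m ≤ k) #I≡b I-bound)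
    ¬boundsB : ¬ BoundsB U? 2 k
    ¬boundsB (_ , IMissesC-bound) = <-irrefl refl (≤-trans (s≤s (subst (_≤ size (IMissesC? U?)) #I≡b
      (size-mono (Class? U? Is) (IMissesC? U?) λ {x} (lx , _) → (lx , _) , cv zero , (lab-cv zero , _) ,
                                                    I-C-adjacency {x} lx (lab-cv zero))))
      (≤-trans (n≤1+n _) IMissesC-bound))

  polar-─ : ∀ v → Polar 2 k (G ─ v)
  polar-─ v = polarOn-─⇒polar v (polarOn-without v)
    where
    polarOn-without : ∀ v → PolarOn 2 k G (∁ ｛ v ｝)
    polarOn-without v with lab v in lv
    ... | St = polarOn-without-S lv (s≤s z≤n) k>0
    ... | Cl = boundsB⇒polarOn (∁? (v ≟_))
                 ( subst (_≤ 2) (≡.sym (trans (size-Class-without lv) #C≡a)) (n≤1+n 1)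
                 , subst (λ m → 2 + m ≤ k) (≡.sym (size-none (IMissesC? (∁? (v ≟_)))
                     λ x (_ , c , (lc , v≢c) , _) → v≢c (unique-C lv lc))) k≥2 )
    ... | Is = boundsA⇒polarOn (∁? (v ≟_))
                 ( ≤-reflexive (trans (size-Class-without lv) #I≡b)
                 , subst (λ m → 2 + m ≤ 2) (≡.sym (size-none (CSeesI? (∁? (v ≟_)))
                     λ c ((lc , _) , x , (lx , _) , e) →
                       contradiction (trans (≡.sym e) (C-I-adjacency {c} {x} lc lx)) λ ())) ≤-refl )

module ExtremalK2 (s : ℕ) (s≥2 : 2 ≤ s) where
  open Extremal s 1 true

  s>0 : 0 < s
  s>0 = ≤-trans (s≤s z≤n) s≥2

  instance
    s-nonZero : NonZero s
    s-nonZero = >-nonZero s>0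

  unique-I : ∀ {u v} → lab u ≡ Is → lab v ≡ Is → u ≡ v
  unique-I {u} {v} lu lv = trans (the-I lu) (≡.sym (the-I lv))
    where
    the-I : ∀ {w} → lab w ≡ Is → w ≡ iv zero
    the-I {w} lw with view w
    ... | S-vertex i    = contradiction (trans (≡.sym (lab-sv i)) lw) λ ()
    ... | C-vertex j    = contradiction (trans (≡.sym (lab-cv j)) lw) λ ()
    ... | I-vertex zero = refl

  ¬polar : ¬ Polar s 2 G
  ¬polar P = [ ¬boundsA , ¬boundsB ]′ (polarOn⇒bounds U? (λ _ → _) (polar⇒polarOn P))
    where
    ¬boundsB : ¬ BoundsB U? s 2
    ¬boundsB (C-bound , _) = <-irrefl refl (subst (λ m → suc m ≤ s) #C≡a C-bound)
    ¬boundsA : ¬ BoundsA U? s 2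
    ¬boundsA (_ , CSeesI-bound) = <-irrefl refl (≤-trans (s≤s (subst (_≤ size (CSeesI? U?)) #C≡a
      (size-mono (Class? U? Cl) (CSeesI? U?) λ {c} (lc , _) → (lc , _) , iv zero , (lab-iv zero , _) ,
                                                    C-I-adjacency {c} lc (lab-iv zero))))
      (≤-trans (n≤1+n _) CSeesI-bound))

  polar-─ : ∀ v → Polar s 2 (G ─ v)
  polar-─ v = polarOn-─⇒polar v (polarOn-without v)
    where
    polarOn-without : ∀ v → PolarOn s 2 G (∁ ｛ v ｝)
    polarOn-without v with lab v in lv
    ... | St = polarOn-without-S lv s>0 (s≤s z≤n)
    ... | Is = boundsA⇒polarOn (∁? (v ≟_))
                 ( subst (_≤ 2) (≡.sym (trans (size-Class-without lv) #I≡b)) (n≤1+n 1)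
                 , subst (λ m → 2 + m ≤ s) (≡.sym (size-none (CSeesI? (∁? (v ≟_)))
                     λ c (_ , x , (lx , v≢x) , _) → v≢x (unique-I lv lx))) s≥2 )
    ... | Cl = boundsB⇒polarOn (∁? (v ≟_))
                 ( ≤-reflexive (trans (size-Class-without lv) #C≡a)
                 , subst (λ m → 2 + m ≤ 2) (≡.sym (size-none (IMissesC? (∁? (v ≟_)))
                     λ x ((lx , _) , c , (lc , _) , e) →
                       contradiction (trans (≡.sym e) (I-C-adjacency {x} {c} lx lc)) λ ())) ≤-refl )

ObstructionOfOrder : ℕ → ℕ → ℕ → Set
ObstructionOfOrder s k m = Σ (Graph m) λ G → PseudoSplit G × MinimalObstruction s k G

extremal-s≡2 : ∀ k → 2 ≤ k → ObstructionOfOrder 2 k (2 + k + 4)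
extremal-s≡2 k k≥2 = subst (ObstructionOfOrder 2 k) (cong (2 +_) (+-comm 4 k))
  (G , (lab , pseudo-split) , ¬polar , polar-─)
  where
  open ExtremalS2 k k≥2
  open Extremal 1 k false

extremal-k≡2 : ∀ s → 2 ≤ s → ObstructionOfOrder s 2 (s + 2 + 4)
extremal-k≡2 s s≥2 =
  subst (ObstructionOfOrder s 2) (trans (cong (5 +_) (+-comm s 1)) (trans (+-comm 6 s) (≡.sym (+-assoc s 2 4))))
  (G , (lab , pseudo-split) , ¬polar , polar-─)
  where
  open ExtremalK2 s s≥2
  open Extremal s 1 true

extremal-obstruction : ∀ s k → 2 ≤ s → 2 ≤ k → s ⊓ k ≡ 2 → ObstructionOfOrder s k (s + k + 4)
extremal-obstruction s k s≥2 k≥2 min≡2 with ⊓-sel s k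
... | inj₁ s⊓k≡s rewrite trans (≡.sym s⊓k≡s) min≡2 = extremal-s≡2 k k≥2
... | inj₂ s⊓k≡k rewrite trans (≡.sym s⊓k≡k) min≡2 = extremal-k≡2 s s≥2

obstruction-structure : ∀ (s k : ℕ) → 2 ≤ s → 2 ≤ k → ∀ {n} (G : Graph n) (lab : Fin n → Part) →
                        IsPseudoSplitPartition G lab → MinimalObstruction s k G →
                        (∃ λ v → lab v ≡ St) × count Cl lab ≤ s × count Is lab ≤ k ×
                        count Cl lab + count Is lab ≤ s + k ∸ 1
obstruction-structure s k s≥2 k≥2 G lab ps obstruction =
    imperfect
  , subst (_≤ s) (≡.sym (count≡size-Class Cl)) C-bounded
  , subst (_≤ k) (≡.sym (count≡size-Class Is)) I-bounded
  , subst (_≤ s + k ∸ 1) (≡.sym (cong₂ _+_ (count≡size-Class Cl) (count≡size-Class Is))) C+I-bounded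
  where
  open PseudoSplitGraph G lab ps
  open Obstruction s≥2 k≥2 G lab ps obstruction

obstruction-order : ∀ (s k : ℕ) → 2 ≤ s → 2 ≤ k → ∀ {n} (G : Graph n) →
                    PseudoSplit G → MinimalObstruction s k G → n ≤ s + k + 4
obstruction-order s k s≥2 k≥2 G (lab , ps) = Obstruction.order-bounded s≥2 k≥2 G lab ps

mainTheorem5 :
      (∀ (s k : ℕ) → 2 ≤ s → 2 ≤ k → ∀ {n} (G : Graph n) (lab : Fin n → Part) →
        IsPseudoSplitPartition G lab → MinimalObstruction s k G →
          (∃ λ v → lab v ≡ St)
          × count Cl lab ≤ s
          × count Is lab ≤ k
          × count Cl lab + count Is lab ≤ s + k ∸ 1)
    × (∀ (s k : ℕ) → 2 ≤ s → 2 ≤ k → ∀ {n} (G : Graph n) →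
        PseudoSplit G → MinimalObstruction s k G → n ≤ s + k + 4)
    × (∀ (s k : ℕ) → 2 ≤ s → 2 ≤ k → s ⊓ k ≡ 2 →
        Σ (Graph (s + k + 4)) λ G → PseudoSplit G × MinimalObstruction s k G)
mainTheorem5 = obstruction-structure , obstruction-order , extremal-obstruction
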